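{- Let $G$ be a finite connected cubic graph (possibly with multiple edges, no loops) with $\nu$ vertices and an even number of edges. Then the number of perfect matchings of the line graph $L(G)$ equals $2^{\nu/2+1}$. Consequently, for any sequence of such graphs $G$ with $\nu\to\infty$, the entropy of $L(G)$, namely $\lim \frac{2\log M(L(G))}{|V(L(G))|}$, equals $\frac{2\log 2}{3}$.
   Context: $M(H)$ denotes the number of perfect matchings of $H$ (parallel edges are distinct edges). For a graph $G$ (possibly with multiple edges, no loops), the line graph $L(G)$ has vertex set $E(G)$, and two distinct vertices $e,f$ are joined by exactly $i$ edges ($i=0,1,2$) iff the edges $e,f$ of $G$ share exactly $i$ end vertices. The entropy of a graph $H$ with $N$ vertices, $N\to\infty$, is $\lim_{N\to\infty}\frac{2\log M(H)}{N}$. -}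

module Defs where

open import Data.Nat using (ℕ; zero; suc; _<ᵇ_; _≡ᵇ_)
open import Data.Bool using (Bool; true; false; _∧_; _∨_; if_then_else_)
open import Data.Fin using (Fin; toℕ; _≟_)
open import Data.Fin.Properties using () renaming (_≟_ to _≟F_)
open import Data.List using (List; []; _∷_; [_]; map; _++_; length; concatMap; replicate; allFin)

countᵇ : ∀ {A : Set} → (A → Bool) → List A → ℕ
countᵇ p [] = 0
countᵇ p (x ∷ xs) = if p x then suc (countᵇ p xs) else countᵇ p xs

allᵇ : ∀ {A : Set} → (A → Bool) → List A → Bool
allᵇ p [] = true
allᵇ p (x ∷ xs) = p x ∧ allᵇ p xs
open import Data.Product using (_×_; _,_; proj₁; proj₂; Σ; ∃)
open import Data.Sum using (_⊎_)
open import Relation.Binary.PropositionalEquality using (_≡_; _≢_)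
open import Relation.Nullary.Decidable using (does)
open import Relation.Unary using (Pred)
open import Relation.Binary.Construct.Closure.ReflexiveTransitive using (Star)
open import Level using (0ℓ)

-- A finite multigraph (loops a priori allowed, parallel edges allowed)
-- with vertex set Fin n and edge set Fin m; edge e has end vertices
-- proj₁ (ends e) and proj₂ (ends e).

record Multigraph : Set where
  field
    n    : ℕ
    m    : ℕ
    ends : Fin m → Fin n × Fin n
open Multigraph public

_=ᶠ_ : ∀ {k} → Fin k → Fin k → Bool
a =ᶠ b = does (a ≟F b)

incidentᵇ : ∀ {k} → Fin k → Fin k × Fin k → Bool
incidentᵇ v (a , b) = (v =ᶠ a) ∨ (v =ᶠ b)

Loopless : Multigraph → Set
Loopless G = ∀ e → proj₁ (ends G e) ≢ proj₂ (ends G e)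

degree : (G : Multigraph) → Fin (n G) → ℕ
degree G v = countᵇ (λ e → incidentᵇ v (ends G e)) (allFin (m G))

Cubic : Multigraph → Set
Cubic G = ∀ v → degree G v ≡ 3

Adjacent : (G : Multigraph) → Fin (n G) → Fin (n G) → Set
Adjacent G u v = ∃ λ e → (ends G e ≡ (u , v)) ⊎ (ends G e ≡ (v , u))

Connected : Multigraph → Set
Connected G = (0 Data.Nat.< n G) × (∀ u v → Star (Adjacent G) u v)
  where import Data.Nat

-- Line graph L(G): vertex set E(G) = Fin m; for distinct edges e, f
-- there are exactly i parallel edges between e and f, where i is the
-- number of end vertices shared by e and f.

shared : (G : Multigraph) → Fin (m G) → Fin (m G) → ℕ
shared G e f = countᵇ (λ v → incidentᵇ v (ends G e) ∧ incidentᵇ v (ends G f)) (allFin (n G))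

lineEdges : (G : Multigraph) → List (Fin (m G) × Fin (m G))
lineEdges G =
  concatMap (λ e → concatMap (λ f →
      if toℕ e <ᵇ toℕ f then replicate (shared G e f) (e , f) else [])
    (allFin (m G))) (allFin (m G))

LineGraph : Multigraph → Multigraph
LineGraph G = record
  { n = m G
  ; m = length (lineEdges G)
  ; ends = Data.List.lookup (lineEdges G)
  }
  where import Data.List

-- Perfect matchings of a multigraph H: sets S of edges of H (edges are
-- Fin (m H), so parallel edges are distinct) such that every vertex is
-- an end of exactly one edge of S.

subsets : ℕ → List (List Bool)
subsets zero    = [ [] ]
subsets (suc k) = map (true ∷_) (subsets k) ++ map (false ∷_) (subsets k)

selected : (H : Multigraph) → List Bool → List (Fin (n H) × Fin (n H))
selected H bs = go bs (allFin (m H))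
  where
  go : List Bool → List (Fin (m H)) → List (Fin (n H) × Fin (n H))
  go (true  ∷ bs) (e ∷ es) = ends H e ∷ go bs es
  go (false ∷ bs) (e ∷ es) = go bs es
  go _ _ = []

isPerfectMatchingᵇ : (H : Multigraph) → List Bool → Bool
isPerfectMatchingᵇ H bs =
  allᵇ (λ v → countᵇ (incidentᵇ v) (selected H bs) ≡ᵇ 1) (allFin (n H))

M : Multigraph → ℕ
M H = countᵇ (isPerfectMatchingᵇ H) (subsets (m H))

-- A perfect matching of L(G) pairs every edge of G with another edge at a common end.
-- Pointing each edge at the end where it is paired gives an orientation of G, and since G
-- is cubic and loopless every in-degree is then 0 or 2; conversely an orientation with all
-- in-degrees even pairs up the (two) edges pointing at each vertex. So M(L(G)) counts the
-- orientations with all in-degrees even.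
--
-- These are counted by a character sum. With σ_S(v) = -1 for v ∈ S and 1 otherwise,
--   2^ν · #even = Σ_o Π_v (1 + (-1)^indeg_o(v)) = Σ_S Σ_o Π_e σ_S(head_o e)
--              = Σ_S Π_e (σ_S(a_e) + σ_S(b_e))   (a_e, b_e the ends of e),
-- and since G is connected only S = ∅ and S = V survive, contributing 2^m + (-2)^m = 2^(m+1)
-- for m even. Double counting incidences gives 3ν = 2m, so #even = 2^(m+1-ν) = 2^(ν/2+1).

module Submission where

open import Defs

open import Algebra.Bundles using (CommutativeSemigroup)
open import Algebra.Structures using (IsCommutativeMonoid)
open import Data.Bool using (Bool; true; false; T; _∧_; _∨_; if_then_else_)
open import Data.Bool.ListAction using (any)
import Data.Bool.Properties as Bool
open import Data.Bool.Properties using (T-∧; T-∨; T-≡; if-swap-then)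
open import Data.Empty using (⊥; ⊥-elim)
open import Data.Fin using (Fin; zero; suc; toℕ; fromℕ<)
import Data.Fin.Properties as Fin
import Data.Integer.Properties as ℤ
open import Data.List using (List; []; _∷_; _++_; map; length; allFin; tabulate; replicate; concatMap; filterᵇ)
import Data.List.Properties as Listₚ
open import Data.List.Properties
  using (length-map; length-++; map-∘; map-cong-local; map-tabulate; length-tabulate; tabulate-lookup; tabulate-cong;
         map-concatMap; concatMap-cong)
open import Data.List.Membership.Propositional using (_∈_; find; lose)
open import Data.List.Membership.Propositional.Properties
  using (∈-map⁺; ∈-map⁻; ∈-concatMap⁺; ∈-concatMap⁻; ∈-++⁺ˡ; ∈-++⁺ʳ; ∈-++⁻; ∈-∃++; ∈-filter⁺; ∈-filter⁻;
         ∈-allFin)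
import Data.List.Relation.Unary.All as All
open import Data.List.Relation.Unary.Any using (here; there)
open import Data.List.Relation.Unary.Any.Properties using (any⁺; any⁻)
open import Data.List.Relation.Unary.Unique.Propositional using (Unique; []; _∷_)
import Data.List.Relation.Unary.Unique.Propositional.Properties as Unique
open import Data.Nat as ℕ using (ℕ; zero; suc; _≤_; z≤n; s≤s)
open import Data.Nat.Divisibility using (_∣_; divides; ∣m+n∣m⇒∣n; n∣m*n)
open import Data.Nat.DivMod using (m*n/n≡m)
open import Data.Nat.Tactic.RingSolver using (solve-∀)
import Data.Nat.Properties as ℕ
open import Data.Product using (_×_; _,_; proj₁; proj₂; ∃-syntax)
open import Data.Sum using (_⊎_; inj₁; inj₂)
open import Function using (_∘_; _⇔_; mk⇔; Equivalence)
open import Level using (0ℓ)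
open import Relation.Binary.Construct.Closure.ReflexiveTransitive using (Star; ε; _◅_)
open import Relation.Binary.Definitions using (DecidableEquality)
open import Relation.Binary.PropositionalEquality
open import Relation.Nullary using (¬_; does; yes; no)
open import Relation.Nullary.Decidable using (T?; dec-true; dec-false)

private
  variable
    A B : Set

-- Counting elements of lists

module _ (p : A → Bool) where

  countᵇ≡length-filterᵇ : ∀ xs → countᵇ p xs ≡ length (filterᵇ p xs)
  countᵇ≡length-filterᵇ [] = refl
  countᵇ≡length-filterᵇ (x ∷ xs) with p x
  ... | true = cong suc (countᵇ≡length-filterᵇ xs)
  ... | false = countᵇ≡length-filterᵇ xs

  countᵇ≡0⇒¬ : ∀ {x xs} → countᵇ p xs ≡ 0 → x ∈ xs → ¬ T (p x)
  countᵇ≡0⇒¬ {xs = y ∷ xs} c x∈ with p y in py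
  countᵇ≡0⇒¬ {xs = y ∷ xs} () x∈ | true
  countᵇ≡0⇒¬ {xs = y ∷ xs} c (here refl) | false = subst T py
  countᵇ≡0⇒¬ {xs = y ∷ xs} c (there x∈) | false = countᵇ≡0⇒¬ c x∈

  countᵇ≡1⇒unique : ∀ {x y xs} → countᵇ p xs ≡ 1 → x ∈ xs → y ∈ xs → T (p x) → T (p y) → x ≡ y
  countᵇ≡1⇒unique {xs = z ∷ xs} c x∈ y∈ px py with p z in pz
  ... | true with x∈ | y∈
  ...   | here refl | here refl = refl
  ...   | here refl | there y∈′ = ⊥-elim (countᵇ≡0⇒¬ (ℕ.suc-injective c) y∈′ py)
  ...   | there x∈′ | _ = ⊥-elim (countᵇ≡0⇒¬ (ℕ.suc-injective c) x∈′ px)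
  countᵇ≡1⇒unique {xs = z ∷ xs} c x∈ y∈ px py | false with x∈ | y∈
  ...   | here refl | _ = ⊥-elim (subst T pz px)
  ...   | _ | here refl = ⊥-elim (subst T pz py)
  ...   | there x∈′ | there y∈′ = countᵇ≡1⇒unique c x∈′ y∈′ px py

  countᵇ≡suc⇒∃ : ∀ {k} xs → countᵇ p xs ≡ suc k → ∃[ x ] (x ∈ xs × T (p x))
  countᵇ≡suc⇒∃ (x ∷ xs) c with p x in px
  ... | true = x , here refl , subst T (sym px) _
  ... | false = let y , y∈ , py = countᵇ≡suc⇒∃ xs c in y , there y∈ , py

  countᵇ≡0 : ∀ xs → (∀ {x} → x ∈ xs → ¬ T (p x)) → countᵇ p xs ≡ 0
  countᵇ≡0 [] _ = refl
  countᵇ≡0 (x ∷ xs) none with p x in px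
  ... | true = ⊥-elim (none (here refl) (subst T (sym px) _))
  ... | false = countᵇ≡0 xs (none ∘ there)

  countᵇ≡1 : ∀ {x xs} → Unique xs → x ∈ xs → T (p x) → (∀ {y} → y ∈ xs → T (p y) → y ≡ x) →
    countᵇ p xs ≡ 1
  countᵇ≡1 {xs = y ∷ xs} (y∉xs ∷ u) x∈ px only with p y in py
  ... | true = cong suc (countᵇ≡0 xs λ z∈ pz → All.lookup y∉xs z∈
                (trans (only (here refl) (subst T (sym py) _)) (sym (only (there z∈) pz))))
  countᵇ≡1 {xs = y ∷ xs} (y∉xs ∷ u) (here refl) px only | false = ⊥-elim (subst T py px)
  countᵇ≡1 {xs = y ∷ xs} (y∉xs ∷ u) (there x∈) px only | false = countᵇ≡1 u x∈ px (only ∘ there)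

module _ {p q : A → Bool} where

  countᵇ-mono : (∀ {x} → T (p x) → T (q x)) → ∀ xs → countᵇ p xs ≤ countᵇ q xs
  countᵇ-mono p⇒q [] = z≤n
  countᵇ-mono p⇒q (x ∷ xs) with p x in px | q x in qx
  ... | true | true = s≤s (countᵇ-mono p⇒q xs)
  ... | true | false = ⊥-elim (subst T qx (p⇒q (subst T (sym px) _)))
  ... | false | true = ℕ.m≤n⇒m≤1+n (countᵇ-mono p⇒q xs)
  ... | false | false = countᵇ-mono p⇒q xs

  countᵇ-cong-local : ∀ xs → (∀ {x} → x ∈ xs → p x ≡ q x) → countᵇ p xs ≡ countᵇ q xs
  countᵇ-cong-local [] _ = refl
  countᵇ-cong-local (x ∷ xs) p≡q rewrite p≡q (here refl) with q x
  ... | true = cong suc (countᵇ-cong-local xs (p≡q ∘ there))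
  ... | false = countᵇ-cong-local xs (p≡q ∘ there)

  countᵇ-∨ : (∀ {x} → T (p x) → ¬ T (q x)) → ∀ xs →
    countᵇ (λ x → p x ∨ q x) xs ≡ countᵇ p xs ℕ.+ countᵇ q xs
  countᵇ-∨ disjoint [] = refl
  countᵇ-∨ disjoint (x ∷ xs) with p x in px | q x in qx
  ... | true | true = ⊥-elim (disjoint (subst T (sym px) _) (subst T (sym qx) _))
  ... | true | false = cong suc (countᵇ-∨ disjoint xs)
  ... | false | true = trans (cong suc (countᵇ-∨ disjoint xs)) (sym (ℕ.+-suc _ _))
  ... | false | false = countᵇ-∨ disjoint xs

countᵇ-map : (p : B → Bool) (f : A → B) (xs : List A) → countᵇ p (map f xs) ≡ countᵇ (p ∘ f) xs
countᵇ-map p f [] = refl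
countᵇ-map p f (x ∷ xs) with p (f x)
... | true = cong suc (countᵇ-map p f xs)
... | false = countᵇ-map p f xs

module _ (p : A → Bool) where

  allᵇ⁺ : ∀ xs → (∀ {x} → x ∈ xs → T (p x)) → T (allᵇ p xs)
  allᵇ⁺ [] _ = _
  allᵇ⁺ (x ∷ xs) all = Equivalence.from T-∧ (all (here refl) , allᵇ⁺ xs (all ∘ there))

  allᵇ⁻ : ∀ {x} xs → T (allᵇ p xs) → x ∈ xs → T (p x)
  allᵇ⁻ (y ∷ xs) all (here refl) = proj₁ (Equivalence.to T-∧ all)
  allᵇ⁻ (y ∷ xs) all (there x∈) = allᵇ⁻ xs (proj₂ (Equivalence.to (T-∧ {p y}) all)) x∈

select : List Bool → List A → List A
select (true ∷ bs) (x ∷ xs) = x ∷ select bs xs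
select (false ∷ bs) (x ∷ xs) = select bs xs
select _ _ = []

select-⊆ : ∀ bs xs {x : A} → x ∈ select bs xs → x ∈ xs
select-⊆ (true ∷ bs) (y ∷ xs) (here refl) = here refl
select-⊆ (true ∷ bs) (y ∷ xs) (there x∈) = there (select-⊆ bs xs x∈)
select-⊆ (false ∷ bs) (y ∷ xs) x∈ = there (select-⊆ bs xs x∈)

select-map : (f : A → B) → ∀ bs xs → select bs (map f xs) ≡ map f (select bs xs)
select-map f (true ∷ bs) (x ∷ xs) = cong (f x ∷_) (select-map f bs xs)
select-map f (false ∷ bs) (x ∷ xs) = select-map f bs xs
select-map f [] xs = refl
select-map f (true ∷ bs) [] = refl
select-map f (false ∷ bs) [] = refl

select-by-map : (p : A → Bool) → ∀ xs → select (map p xs) xs ≡ filterᵇ p xs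
select-by-map p [] = refl
select-by-map p (x ∷ xs) with p x
... | true = cong (x ∷_) (select-by-map p xs)
... | false = select-by-map p xs

map≡ᵇselect : (p : A → Bool) → ∀ bs {xs} → length bs ≡ length xs → Unique xs →
  (∀ {x} → x ∈ xs → T (p x) → x ∈ select bs xs) → (∀ {x} → x ∈ select bs xs → T (p x)) →
  map p xs ≡ bs
map≡ᵇselect p [] {[]} _ _ _ _ = refl
map≡ᵇselect p (true ∷ bs) {x ∷ xs} len (x∉ ∷ u) sel⇐p sel⇒p =
  cong₂ _∷_ (Equivalence.to T-≡ (sel⇒p (here refl)))
    (map≡ᵇselect p bs (ℕ.suc-injective len) u (λ y∈ py → tail y∈ (sel⇐p (there y∈) py)) (sel⇒p ∘ there))
  where
  tail : ∀ {y} → y ∈ xs → y ∈ x ∷ select bs xs → y ∈ select bs xs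
  tail y∈ (here refl) = ⊥-elim (All.lookup x∉ y∈ refl)
  tail y∈ (there y∈′) = y∈′
map≡ᵇselect p (false ∷ bs) {x ∷ xs} len (x∉ ∷ u) sel⇐p sel⇒p =
  cong₂ _∷_ px≡false (map≡ᵇselect p bs (ℕ.suc-injective len) u (sel⇐p ∘ there) sel⇒p)
  where
  px≡false : p x ≡ false
  px≡false with p x in px
  ... | true = ⊥-elim (All.lookup x∉ (select-⊆ bs xs (sel⇐p (here refl) (subst T (sym px) _))) refl)
  ... | false = refl

-- `selected` recurses through a `where`-bound helper that cannot be named; after one
-- unfolding step unification recovers that helper as `go` below.
SelectLike : {C : Set} (f : A → B) (go : C → List Bool → List A → List B) → Set
SelectLike f go =
  (∀ c bs x xs → go c (true ∷ bs) (x ∷ xs) ≡ f x ∷ go c bs xs) ×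
  (∀ c bs x xs → go c (false ∷ bs) (x ∷ xs) ≡ go c bs xs) ×
  (∀ c xs → go c [] xs ≡ []) ×
  (∀ c bs → go c bs [] ≡ [])

selectLike≡select-map : {C : Set} (f : A → B) (go : C → List Bool → List A → List B) →
  ∀ c bs xs → SelectLike f go → go c bs xs ≡ select bs (map f xs)
selectLike≡select-map f go c (true ∷ bs) (x ∷ xs) eqs@(go-true , _) =
  trans (go-true c bs x xs) (cong (f x ∷_) (selectLike≡select-map f go c bs xs eqs))
selectLike≡select-map f go c (false ∷ bs) (x ∷ xs) eqs@(_ , go-false , _) =
  trans (go-false c bs x xs) (selectLike≡select-map f go c bs xs eqs)
selectLike≡select-map f go c [] xs (_ , _ , go-[] , _) = go-[] c xs
selectLike≡select-map f go c (true ∷ bs) [] (_ , _ , _ , go-[]) = go-[] c _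
selectLike≡select-map f go c (false ∷ bs) [] (_ , _ , _ , go-[]) = go-[] c _

selected≡select : (H : Multigraph) (bs : List Bool) → selected H bs ≡ select bs (map (ends H) (allFin (m H)))
selected≡select H bs with selectLike≡select-map (ends H) _ | allFin (m H) | bs
... | _ | es | [] = refl
... | _ | [] | true ∷ _ = refl
... | _ | [] | false ∷ _ = refl
... | go≡ | e ∷ es | true ∷ bs′ with true ∷ bs′
...   | c = cong (ends H e ∷_) (go≡ c bs′ es selectLike)
  where
  selectLike = (λ _ _ _ _ → refl) , (λ _ _ _ _ → refl) , (λ _ _ → refl) ,
               λ { _ [] → refl ; _ (true ∷ _) → refl ; _ (false ∷ _) → refl }
selected≡select H bs | go≡ | e ∷ es | false ∷ bs′ with false ∷ bs′
...   | c = go≡ c bs′ es selectLike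
  where
  selectLike = (λ _ _ _ _ → refl) , (λ _ _ _ _ → refl) , (λ _ _ → refl) ,
               λ { _ [] → refl ; _ (true ∷ _) → refl ; _ (false ∷ _) → refl }

unique-⊆⇒length≤ : ∀ {xs ys : List A} → Unique xs → (∀ {x} → x ∈ xs → x ∈ ys) → length xs ≤ length ys
unique-⊆⇒length≤ {xs = []} _ _ = z≤n
unique-⊆⇒length≤ {xs = x ∷ xs} {ys} (x∉xs ∷ u) xs⊆ys with ∈-∃++ (xs⊆ys (here refl))
... | us , vs , refl = ℕ.≤-trans (s≤s (unique-⊆⇒length≤ u xs⊆us++vs)) (ℕ.≤-reflexive (sym length-us++x∷vs))
  where
  xs⊆us++vs : ∀ {y} → y ∈ xs → y ∈ us ++ vs
  xs⊆us++vs {y} y∈xs with ∈-++⁻ us (xs⊆ys (there y∈xs))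
  ... | inj₁ y∈us = ∈-++⁺ˡ y∈us
  ... | inj₂ (here refl) = ⊥-elim (All.lookup x∉xs y∈xs refl)
  ... | inj₂ (there y∈vs) = ∈-++⁺ʳ us y∈vs
  length-us++x∷vs : length (us ++ x ∷ vs) ≡ suc (length (us ++ vs))
  length-us++x∷vs = trans (length-++ us) (trans (ℕ.+-suc (length us) (length vs)) (cong suc (sym (length-++ us))))

module _ {p : A → Bool} {q : B → Bool} where

  countᵇ-≤-retraction : ∀ {xs ys} → Unique xs → (f : A → B) (g : B → A) →
    (∀ {x} → x ∈ xs → T (p x) → f x ∈ ys × T (q (f x))) →
    (∀ {x} → x ∈ xs → T (p x) → g (f x) ≡ x) →
    countᵇ p xs ≤ countᵇ q ys
  countᵇ-≤-retraction {xs} {ys} u f g maps-to retraction = begin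
    countᵇ p xs                   ≡⟨ countᵇ≡length-filterᵇ p xs ⟩
    length (filterᵇ p xs)         ≡⟨ length-map f (filterᵇ p xs) ⟨
    length (map f (filterᵇ p xs)) ≤⟨ unique-⊆⇒length≤ image-unique image⊆ ⟩
    length (filterᵇ q ys)         ≡⟨ countᵇ≡length-filterᵇ q ys ⟨
    countᵇ q ys                   ∎
    where
    open ℕ.≤-Reasoning
    image-unique : Unique (map f (filterᵇ p xs))
    image-unique = Unique.map⁻ (subst Unique (sym g∘f≡id) (Unique.filter⁺ (T? ∘ p) u))
      where
      g∘f≡id : map g (map f (filterᵇ p xs)) ≡ filterᵇ p xs
      g∘f≡id = trans (sym (map-∘ (filterᵇ p xs)))
        (trans (map-cong-local (All.tabulate λ x∈ → let x∈xs , px = ∈-filter⁻ (T? ∘ p) x∈ in retraction x∈xs px))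
               (Listₚ.map-id (filterᵇ p xs)))
    image⊆ : ∀ {y} → y ∈ map f (filterᵇ p xs) → y ∈ filterᵇ q ys
    image⊆ y∈ with ∈-map⁻ f y∈
    ... | x , x∈ , refl = let x∈xs , px = ∈-filter⁻ (T? ∘ p) x∈ ; fx∈ , qfx = maps-to x∈xs px
                          in ∈-filter⁺ (T? ∘ q) fx∈ qfx

countᵇ-bijection : {p : A → Bool} {q : B → Bool} {xs : List A} {ys : List B} → Unique xs → Unique ys →
  (f : A → B) (g : B → A) →
  (∀ {x} → x ∈ xs → T (p x) → f x ∈ ys × T (q (f x))) →
  (∀ {y} → y ∈ ys → T (q y) → g y ∈ xs × T (p (g y))) →
  (∀ {x} → x ∈ xs → T (p x) → g (f x) ≡ x) →
  (∀ {y} → y ∈ ys → T (q y) → f (g y) ≡ y) →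
  countᵇ p xs ≡ countᵇ q ys
countᵇ-bijection uxs uys f g f-maps-to g-maps-to g∘f≡id f∘g≡id =
  ℕ.≤-antisym (countᵇ-≤-retraction uxs f g f-maps-to g∘f≡id) (countᵇ-≤-retraction uys g f g-maps-to f∘g≡id)

map-const : (c : B) (xs : List A) → map (λ _ → c) xs ≡ replicate (length xs) c
map-const c [] = refl
map-const c (x ∷ xs) = cong (c ∷_) (map-const c xs)

concatMap-unique : (f : A → List B) (key : B → A) → (∀ x → Unique (f x)) → (∀ {x y} → y ∈ f x → key y ≡ x) →
  ∀ {xs} → Unique xs → Unique (concatMap f xs)
concatMap-unique f key f-unique keyed [] = []
concatMap-unique f key f-unique keyed {x ∷ xs} (x∉xs ∷ u) =
  Unique.++⁺ (f-unique x) (concatMap-unique f key f-unique keyed u) disjoint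
  where
  disjoint : ∀ {y} → y ∈ f x × y ∈ concatMap f xs → ⊥
  disjoint (y∈fx , y∈rest) with find (∈-concatMap⁻ f y∈rest)
  ... | z , z∈xs , y∈fz = All.lookup x∉xs z∈xs (trans (sym (keyed y∈fx)) (keyed y∈fz))

∈-subsets⁺ : ∀ k {bs} → length bs ≡ k → bs ∈ subsets k
∈-subsets⁺ zero {[]} _ = here refl
∈-subsets⁺ (suc k) {true ∷ bs} len = ∈-++⁺ˡ (∈-map⁺ (true ∷_) (∈-subsets⁺ k (ℕ.suc-injective len)))
∈-subsets⁺ (suc k) {false ∷ bs} len =
  ∈-++⁺ʳ (map (true ∷_) (subsets k)) (∈-map⁺ (false ∷_) (∈-subsets⁺ k (ℕ.suc-injective len)))

∈-subsets⁻ : ∀ k {bs} → bs ∈ subsets k → length bs ≡ k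
∈-subsets⁻ zero (here refl) = refl
∈-subsets⁻ (suc k) bs∈ with ∈-++⁻ (map (true ∷_) (subsets k)) bs∈
... | inj₁ bs∈ with _ , bs′∈ , refl ← ∈-map⁻ (true ∷_) bs∈ = cong suc (∈-subsets⁻ k bs′∈)
... | inj₂ bs∈ with _ , bs′∈ , refl ← ∈-map⁻ (false ∷_) bs∈ = cong suc (∈-subsets⁻ k bs′∈)

subsets-unique : ∀ k → Unique (subsets k)
subsets-unique zero = All.[] ∷ []
subsets-unique (suc k) =
  Unique.++⁺ (Unique.map⁺ ∷-injectiveʳ (subsets-unique k)) (Unique.map⁺ ∷-injectiveʳ (subsets-unique k)) disjoint
  where
  open Listₚ using (∷-injectiveʳ)
  disjoint : ∀ {bs} → bs ∈ map (true ∷_) (subsets k) × bs ∈ map (false ∷_) (subsets k) → ⊥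
  disjoint (t∈ , f∈) with _ , _ , refl ← ∈-map⁻ (true ∷_) t∈ | _ , _ , () ← ∈-map⁻ (false ∷_) f∈

length-allFin : ∀ k → length (allFin k) ≡ k
length-allFin k = length-tabulate {n = k} (λ i → i)

-- Junk value false past the end of the list.
_‼_ : ∀ {k} → List Bool → Fin k → Bool
[] ‼ _ = false
(b ∷ bs) ‼ zero = b
(b ∷ bs) ‼ suc i = bs ‼ i

tabulate-‼ : ∀ {k} (h : Fin k → Bool) (i : Fin k) → tabulate h ‼ i ≡ h i
tabulate-‼ h zero = refl
tabulate-‼ h (suc i) = tabulate-‼ (h ∘ suc) i

‼-tabulate : ∀ k bs → length bs ≡ k → tabulate {n = k} (bs ‼_) ≡ bs
‼-tabulate zero [] _ = refl
‼-tabulate (suc k) (b ∷ bs) len = cong (b ∷_) (‼-tabulate k bs (ℕ.suc-injective len))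

replicate-‼ : ∀ {k} c (i : Fin k) → replicate k c ‼ i ≡ c
replicate-‼ c zero = refl
replicate-‼ c (suc i) = replicate-‼ c i

-- Sums and products over lists

module BigOperator {C : Set} {_∙_ : C → C → C} {ε : C} (isCM : IsCommutativeMonoid _≡_ _∙_ ε) where

  open IsCommutativeMonoid isCM using (assoc; identityˡ; identityʳ; isCommutativeSemigroup)

  private
    commutativeSemigroup : CommutativeSemigroup 0ℓ 0ℓ
    commutativeSemigroup = record { isCommutativeSemigroup = isCommutativeSemigroup }

  open import Algebra.Properties.CommutativeSemigroup commutativeSemigroup using (interchange)

  fold : List A → (A → C) → C
  fold [] f = ε
  fold (x ∷ xs) f = f x ∙ fold xs f

  fold-++ : ∀ xs ys (f : A → C) → fold (xs ++ ys) f ≡ fold xs f ∙ fold ys f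
  fold-++ [] ys f = sym (identityˡ _)
  fold-++ (x ∷ xs) ys f = trans (cong (f x ∙_) (fold-++ xs ys f)) (sym (assoc _ _ _))

  fold-map : (g : B → A) (xs : List B) (f : A → C) → fold (map g xs) f ≡ fold xs (f ∘ g)
  fold-map g [] f = refl
  fold-map g (x ∷ xs) f = cong (f (g x) ∙_) (fold-map g xs f)

  fold-cong-local : ∀ xs {f g : A → C} → (∀ {x} → x ∈ xs → f x ≡ g x) → fold xs f ≡ fold xs g
  fold-cong-local [] _ = refl
  fold-cong-local (x ∷ xs) f≡g = cong₂ _∙_ (f≡g (here refl)) (fold-cong-local xs (f≡g ∘ there))

  fold-ε : (xs : List A) → fold xs (λ _ → ε) ≡ ε
  fold-ε [] = refl
  fold-ε (x ∷ xs) = trans (identityˡ _) (fold-ε xs)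

  fold-∙ : ∀ xs (f g : A → C) → fold xs (λ x → f x ∙ g x) ≡ fold xs f ∙ fold xs g
  fold-∙ [] f g = sym (identityˡ ε)
  fold-∙ (x ∷ xs) f g = trans (cong ((f x ∙ g x) ∙_) (fold-∙ xs f g)) (interchange _ _ _ _)

  fold-comm : (xs : List A) (ys : List B) (f : A → B → C) →
    fold xs (λ x → fold ys (f x)) ≡ fold ys (λ y → fold xs (λ x → f x y))
  fold-comm [] ys f = sym (fold-ε ys)
  fold-comm (x ∷ xs) ys f =
    trans (cong (fold ys (f x) ∙_) (fold-comm xs ys f)) (sym (fold-∙ ys (f x) (λ y → fold xs (λ x → f x y))))

  fold-allFin-suc : ∀ k (f : Fin (suc k) → C) → fold (allFin (suc k)) f ≡ f zero ∙ fold (allFin k) (f ∘ suc)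
  fold-allFin-suc k f =
    cong (f zero ∙_) (trans (cong (λ xs → fold xs f) (sym (map-tabulate id suc))) (fold-map suc (allFin k) f))
    where open Function using (id)

  fold-point : (_≟_ : DecidableEquality A) → ∀ {xs} → Unique xs → ∀ {a} → a ∈ xs → (f : A → C) →
    fold xs (λ x → if does (a ≟ x) then f x else ε) ≡ f a
  fold-point _≟_ {x ∷ xs} (x∉xs ∷ u) (here refl) f with x ≟ x
  ... | no x≢x = ⊥-elim (x≢x refl)
  ... | yes _ = trans (cong (f x ∙_) (trans (fold-cong-local xs off) (fold-ε xs))) (identityʳ (f x))
    where
    off : ∀ {y} → y ∈ xs → (if does (x ≟ y) then f y else ε) ≡ ε
    off y∈ = cong (if_then f _ else ε) (dec-false (x ≟ _) (All.lookup x∉xs y∈))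
  fold-point _≟_ {x ∷ xs} (x∉xs ∷ u) {a} (there a∈) f with a ≟ x
  ... | yes refl = ⊥-elim (All.lookup x∉xs a∈ refl)
  ... | no _ = trans (identityˡ _) (fold-point _≟_ u a∈ f)

evenᵇ : ℕ → Bool
evenᵇ zero = true
evenᵇ (suc zero) = false
evenᵇ (suc (suc k)) = evenᵇ k

module IntegerSums where

  open import Data.Integer using (ℤ; +_; -_; _+_; _*_; _^_; 0ℤ; 1ℤ; -1ℤ)

  module ∑ = BigOperator ℤ.+-0-isCommutativeMonoid
  module ∏ = BigOperator ℤ.*-1-isCommutativeMonoid

  ∑ ∏ : List A → (A → ℤ) → ℤ
  ∑ = ∑.fold
  ∏ = ∏.fold

  infix 5 ∑ ∏
  syntax ∑ xs (λ x → e) = ∑[ x ∈ xs ] e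
  syntax ∏ xs (λ x → e) = ∏[ x ∈ xs ] e

  χ : Bool → ℤ
  χ true = 1ℤ
  χ false = 0ℤ

  countᵇ≡∑χ : (p : A → Bool) (xs : List A) → + countᵇ p xs ≡ ∑[ x ∈ xs ] χ (p x)
  countᵇ≡∑χ p [] = refl
  countᵇ≡∑χ p (x ∷ xs) with p x
  ... | true = cong (_+_ 1ℤ) (countᵇ≡∑χ p xs)
  ... | false = trans (countᵇ≡∑χ p xs) (sym (ℤ.+-identityˡ _))

  ∑-const : (xs : List A) (c : ℕ) → ∑[ x ∈ xs ] + c ≡ + (length xs ℕ.* c)
  ∑-const [] c = refl
  ∑-const (x ∷ xs) c = trans (cong (_+_ (+ c)) (∑-const xs c)) (sym (ℤ.pos-+ c (length xs ℕ.* c)))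

  ∑-*ˡ : (c : ℤ) (xs : List A) (f : A → ℤ) → ∑[ x ∈ xs ] (c * f x) ≡ c * ∑ xs f
  ∑-*ˡ c [] f = sym (ℤ.*-zeroʳ c)
  ∑-*ˡ c (x ∷ xs) f = trans (cong (_+_ (c * f x)) (∑-*ˡ c xs f)) (sym (ℤ.*-distribˡ-+ c (f x) _))

  ∏-const : (xs : List A) (c : ℤ) → ∏[ x ∈ xs ] c ≡ c ^ length xs
  ∏-const [] c = refl
  ∏-const (x ∷ xs) c = cong (c *_) (∏-const xs c)

  ∏-zero : ∀ xs (f : A → ℤ) {x} → x ∈ xs → f x ≡ 0ℤ → ∏ xs f ≡ 0ℤ
  ∏-zero (y ∷ xs) f (here refl) fx≡0 = cong (_* ∏ xs f) fx≡0
  ∏-zero (y ∷ xs) f (there x∈) fx≡0 = trans (cong (f y *_) (∏-zero xs f x∈ fx≡0)) (ℤ.*-zeroʳ (f y))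

  χ-allᵇ : (p : A → Bool) (xs : List A) → χ (allᵇ p xs) ≡ ∏[ x ∈ xs ] χ (p x)
  χ-allᵇ p [] = refl
  χ-allᵇ p (x ∷ xs) with p x
  ... | true = trans (χ-allᵇ p xs) (sym (ℤ.*-identityˡ _))
  ... | false = sym (ℤ.*-zeroˡ (∏[ y ∈ xs ] χ (p y)))

  -1^countᵇ : (p : A → Bool) (xs : List A) → -1ℤ ^ countᵇ p xs ≡ ∏[ x ∈ xs ] (if p x then -1ℤ else 1ℤ)
  -1^countᵇ p [] = refl
  -1^countᵇ p (x ∷ xs) with p x
  ... | true = cong (-1ℤ *_) (-1^countᵇ p xs)
  ... | false = trans (-1^countᵇ p xs) (sym (ℤ.*-identityˡ _))

  2χ-evenᵇ : ∀ k → + 2 * χ (evenᵇ k) ≡ 1ℤ + -1ℤ ^ k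
  2χ-evenᵇ zero = refl
  2χ-evenᵇ (suc zero) = refl
  2χ-evenᵇ (suc (suc k)) =
    trans (2χ-evenᵇ k) (cong (_+_ 1ℤ) (sym (trans (sym (ℤ.*-assoc -1ℤ -1ℤ (-1ℤ ^ k))) (ℤ.*-identityˡ (-1ℤ ^ k)))))

  if-then-∏ : ∀ b (xs : List A) (f : A → ℤ) → (if b then ∏ xs f else 1ℤ) ≡ ∏[ x ∈ xs ] (if b then f x else 1ℤ)
  if-then-∏ true xs f = refl
  if-then-∏ false xs f = sym (∏.fold-ε xs)

  -2^even : ∀ q → (- + 2) ^ (2 ℕ.* q) ≡ (+ 2) ^ (2 ℕ.* q)
  -2^even q = trans (sym (ℤ.^-*-assoc (- + 2) 2 q)) (ℤ.^-*-assoc (+ 2) 2 q)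

  pos-^ : ∀ a k → + (a ℕ.^ k) ≡ (+ a) ^ k
  pos-^ a zero = refl
  pos-^ a (suc k) = trans (ℤ.pos-* a (a ℕ.^ k)) (cong (+ a *_) (pos-^ a k))

  ∑-subsets-∏ : ∀ k (F : Fin k → Bool → ℤ) →
    ∑[ bs ∈ subsets k ] ∏[ i ∈ allFin k ] F i (bs ‼ i) ≡ ∏[ i ∈ allFin k ] (F i true + F i false)
  ∑-subsets-∏ zero F = refl
  ∑-subsets-∏ (suc k) F = begin
    ∑[ bs ∈ map (true ∷_) (subsets k) ++ map (false ∷_) (subsets k) ] ∏[ i ∈ allFin (suc k) ] F i (bs ‼ i)
      ≡⟨ ∑.fold-++ (map (true ∷_) (subsets k)) _ _ ⟩
    (∑[ bs ∈ map (true ∷_) (subsets k) ] ∏[ i ∈ allFin (suc k) ] F i (bs ‼ i)) +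
    (∑[ bs ∈ map (false ∷_) (subsets k) ] ∏[ i ∈ allFin (suc k) ] F i (bs ‼ i))
      ≡⟨ cong₂ _+_ (branch true) (branch false) ⟩
    F zero true * rest + F zero false * rest
      ≡⟨ ℤ.*-distribʳ-+ rest (F zero true) (F zero false) ⟨
    (F zero true + F zero false) * rest
      ≡⟨ cong ((F zero true + F zero false) *_) (∑-subsets-∏ k (F ∘ suc)) ⟩
    (F zero true + F zero false) * (∏[ i ∈ allFin k ] F (suc i) true + F (suc i) false)
      ≡⟨ ∏.fold-allFin-suc k (λ i → F i true + F i false) ⟨
    ∏[ i ∈ allFin (suc k) ] (F i true + F i false) ∎
    where
    open ≡-Reasoning
    rest = ∑[ bs ∈ subsets k ] ∏[ i ∈ allFin k ] F (suc i) (bs ‼ i)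
    branch : ∀ b → ∑[ bs ∈ map (b ∷_) (subsets k) ] ∏[ i ∈ allFin (suc k) ] F i (bs ‼ i) ≡ F zero b * rest
    branch b = begin
      ∑[ bs ∈ map (b ∷_) (subsets k) ] ∏[ i ∈ allFin (suc k) ] F i (bs ‼ i)
        ≡⟨ ∑.fold-map (b ∷_) (subsets k) _ ⟩
      ∑[ bs ∈ subsets k ] ∏[ i ∈ allFin (suc k) ] F i ((b ∷ bs) ‼ i)
        ≡⟨ ∑.fold-cong-local (subsets k) (λ {bs} _ → ∏.fold-allFin-suc k (λ i → F i ((b ∷ bs) ‼ i))) ⟩
      ∑[ bs ∈ subsets k ] (F zero b * (∏[ i ∈ allFin k ] F (suc i) (bs ‼ i)))
        ≡⟨ ∑-*ˡ (F zero b) (subsets k) _ ⟩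
      F zero b * rest ∎

open IntegerSums

-- Incidence and the line graph

module _ {k : ℕ} where

  =ᶠ-refl : (a : Fin k) → T (a =ᶠ a)
  =ᶠ-refl a with a Fin.≟ a
  ... | yes _ = _
  ... | no a≢a = a≢a refl

  =ᶠ⇒≡ : {a b : Fin k} → T (a =ᶠ b) → a ≡ b
  =ᶠ⇒≡ {a} {b} a=b with a Fin.≟ b
  ... | yes a≡b = a≡b

  ≡⇒=ᶠ : {a b : Fin k} → a ≡ b → T (a =ᶠ b)
  ≡⇒=ᶠ {a} refl = =ᶠ-refl a

  incidentᵇ⁻ : ∀ {v a b : Fin k} → T (incidentᵇ v (a , b)) → v ≡ a ⊎ v ≡ b
  incidentᵇ⁻ {v} {a} inc with Equivalence.to (T-∨ {v =ᶠ a}) inc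
  ... | inj₁ v=a = inj₁ (=ᶠ⇒≡ v=a)
  ... | inj₂ v=b = inj₂ (=ᶠ⇒≡ v=b)

  incidentᵇ-first : (a b : Fin k) → T (incidentᵇ a (a , b))
  incidentᵇ-first a b = Equivalence.from T-∨ (inj₁ (=ᶠ-refl a))

  incidentᵇ-second : (a b : Fin k) → T (incidentᵇ b (a , b))
  incidentᵇ-second a b = Equivalence.from (T-∨ {b =ᶠ a}) (inj₂ (=ᶠ-refl b))

  =ᶠ-≡-true : (a : Fin k) → (a =ᶠ a) ≡ true
  =ᶠ-≡-true a = dec-true (a Fin.≟ a) refl

  =ᶠ-≡-false : {a b : Fin k} → a ≢ b → (a =ᶠ b) ≡ false
  =ᶠ-≡-false {a} {b} = dec-false (a Fin.≟ b)

  countᵇ-=ᶠ : (a : Fin k) → countᵇ (_=ᶠ a) (allFin k) ≡ 1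
  countᵇ-=ᶠ a = countᵇ≡1 (_=ᶠ a) (Unique.allFin⁺ k) (∈-allFin a) (=ᶠ-refl a) (λ _ → =ᶠ⇒≡)

module Incidence (G : Multigraph) where

  open import Data.Integer using (+_)

  E V : Set
  E = Fin (m G)
  V = Fin (n G)

  end₁ end₂ : E → V
  end₁ e = proj₁ (ends G e)
  end₂ e = proj₂ (ends G e)

  inc : V → E → Bool
  inc v e = incidentᵇ v (ends G e)

  inc-end₁ : ∀ e → T (inc (end₁ e) e)
  inc-end₁ e = incidentᵇ-first (end₁ e) (end₂ e)

  inc-end₂ : ∀ e → T (inc (end₂ e) e)
  inc-end₂ e = incidentᵇ-second (end₁ e) (end₂ e)

  countᵇ-inc-ends : Loopless G → ∀ e → countᵇ (λ v → inc v e) (allFin (n G)) ≡ 2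
  countᵇ-inc-ends loopless e =
    trans (countᵇ-∨ (λ {v} v=a v=b → loopless e (trans (sym (=ᶠ⇒≡ {a = v} v=a)) (=ᶠ⇒≡ v=b))) (allFin (n G)))
          (cong₂ ℕ._+_ (countᵇ-=ᶠ (end₁ e)) (countᵇ-=ᶠ (end₂ e)))

  handshake : Loopless G → Cubic G → n G ℕ.* 3 ≡ m G ℕ.* 2
  handshake loopless cubic = ℤ.+-injective (begin
    + (n G ℕ.* 3)
      ≡⟨ cong (λ k → + (k ℕ.* 3)) (length-allFin (n G)) ⟨
    + (length (allFin (n G)) ℕ.* 3)
      ≡⟨ ∑-const (allFin (n G)) 3 ⟨
    ∑[ v ∈ allFin (n G) ] + 3
      ≡⟨ ∑.fold-cong-local (allFin (n G)) (λ {v} _ → degree-as-∑ v) ⟩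
    ∑[ v ∈ allFin (n G) ] ∑[ e ∈ allFin (m G) ] χ (inc v e)
      ≡⟨ ∑.fold-comm (allFin (n G)) (allFin (m G)) _ ⟩
    ∑[ e ∈ allFin (m G) ] ∑[ v ∈ allFin (n G) ] χ (inc v e)
      ≡⟨ ∑.fold-cong-local (allFin (m G)) (λ {e} _ → ends-as-∑ e) ⟩
    ∑[ e ∈ allFin (m G) ] + 2
      ≡⟨ ∑-const (allFin (m G)) 2 ⟩
    + (length (allFin (m G)) ℕ.* 2)
      ≡⟨ cong (λ k → + (k ℕ.* 2)) (length-allFin (m G)) ⟩
    + (m G ℕ.* 2) ∎)
    where
    open ≡-Reasoning
    degree-as-∑ : ∀ v → + 3 ≡ ∑[ e ∈ allFin (m G) ] χ (inc v e)
    degree-as-∑ v = trans (cong +_ (sym (cubic v))) (countᵇ≡∑χ (inc v) (allFin (m G)))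
    ends-as-∑ : ∀ e → ∑[ v ∈ allFin (n G) ] χ (inc v e) ≡ + 2
    ends-as-∑ e = trans (sym (countᵇ≡∑χ (λ v → inc v e) (allFin (n G)))) (cong +_ (countᵇ-inc-ends loopless e))

module LineGraphTriples (G : Multigraph) where

  open Incidence G

  -- (e , f , v) with toℕ e < toℕ f and v an end of both e and f: the copies of
  -- the edge ef of L(G) are told apart by the shared end v.
  Triple : Set
  Triple = E × E × V

  edgePair : Triple → E × E
  edgePair (e , f , _) = e , f

  meet : Triple → V
  meet (_ , _ , v) = v

  commonEnd : E → E → V → Bool
  commonEnd e f v = inc v e ∧ inc v f

  triplesAt : E → E → List Triple
  triplesAt e f =
    if toℕ e ℕ.<ᵇ toℕ f then map (λ v → e , f , v) (filterᵇ (commonEnd e f) (allFin (n G))) else []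

  triples : List Triple
  triples = concatMap (λ e → concatMap (triplesAt e) (allFin (m G))) (allFin (m G))

  lineEdges≡ : lineEdges G ≡ map edgePair triples
  lineEdges≡ = sym (begin
    map edgePair triples
      ≡⟨ map-concatMap edgePair _ (allFin (m G)) ⟩
    concatMap (λ e → map edgePair (concatMap (triplesAt e) (allFin (m G)))) (allFin (m G))
      ≡⟨ concatMap-cong (λ e → trans (map-concatMap edgePair _ (allFin (m G))) (concatMap-cong (copies e) (allFin (m G))))
                        (allFin (m G)) ⟩
    lineEdges G ∎)
    where
    open ≡-Reasoning
    copies : ∀ e f → map edgePair (triplesAt e f) ≡ (if toℕ e ℕ.<ᵇ toℕ f then replicate (shared G e f) (e , f) else [])
    copies e f with toℕ e ℕ.<ᵇ toℕ f
    ... | false = refl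
    ... | true = trans (sym (map-∘ (filterᵇ (commonEnd e f) (allFin (n G)))))
                  (trans (map-const (e , f) (filterᵇ (commonEnd e f) (allFin (n G))))
                         (cong (λ k → replicate k (e , f)) (sym (countᵇ≡length-filterᵇ (commonEnd e f) (allFin (n G))))))

  selected-lineGraph : ∀ bs → selected (LineGraph G) bs ≡ map edgePair (select bs triples)
  selected-lineGraph bs = begin
    selected (LineGraph G) bs                                   ≡⟨ selected≡select (LineGraph G) bs ⟩
    select bs (map (Data.List.lookup (lineEdges G)) (allFin _)) ≡⟨ cong (select bs) (map-tabulate (λ i → i) _) ⟩
    select bs (tabulate (Data.List.lookup (lineEdges G)))       ≡⟨ cong (select bs) (tabulate-lookup (lineEdges G)) ⟩
    select bs (lineEdges G)                                     ≡⟨ cong (select bs) lineEdges≡ ⟩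
    select bs (map edgePair triples)                            ≡⟨ select-map edgePair bs triples ⟩
    map edgePair (select bs triples)                            ∎
    where open ≡-Reasoning

  ∈-triples⁻ : ∀ {e f v} → (e , f , v) ∈ triples → toℕ e ℕ.< toℕ f × T (inc v e) × T (inc v f)
  ∈-triples⁻ t∈ with find (∈-concatMap⁻ (λ e → concatMap (triplesAt e) (allFin (m G))) {xs = allFin (m G)} t∈)
  ... | e , _ , t∈′ with find (∈-concatMap⁻ (triplesAt e) {xs = allFin (m G)} t∈′)
  ... | f , _ , t∈″ with toℕ e ℕ.<ᵇ toℕ f in e<f
  ... | false with () ← t∈″
  ... | true with ∈-map⁻ (λ v → e , f , v) t∈″
  ... | v , v∈ , refl =
    ℕ.<ᵇ⇒< (toℕ e) (toℕ f) (subst T (sym e<f) _) ,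
    Equivalence.to T-∧ (proj₂ (∈-filter⁻ (T? ∘ commonEnd e f) {xs = allFin (n G)} v∈))

  ∈-triples⁺ : ∀ {e f v} → toℕ e ℕ.< toℕ f → T (inc v e) → T (inc v f) → (e , f , v) ∈ triples
  ∈-triples⁺ {e} {f} {v} e<f ve vf =
    ∈-concatMap⁺ (λ e → concatMap (triplesAt e) (allFin (m G)))
      (Any.map (λ { refl → ∈-concatMap⁺ (triplesAt e) (Any.map (λ { refl → ∈-at }) (∈-allFin f)) }) (∈-allFin e))
    where
    import Data.List.Relation.Unary.Any as Any
    ∈-at : (e , f , v) ∈ triplesAt e f
    ∈-at rewrite Equivalence.to T-≡ (ℕ.<⇒<ᵇ e<f) =
      ∈-map⁺ _ (∈-filter⁺ (T? ∘ commonEnd e f) (∈-allFin v) (Equivalence.from T-∧ (ve , vf)))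

  triples-unique : Unique triples
  triples-unique =
    concatMap-unique _ proj₁ (λ e → concatMap-unique _ (proj₁ ∘ proj₂) (at-unique e) (at-keyed e) (Unique.allFin⁺ (m G)))
      keyed (Unique.allFin⁺ (m G))
    where
    at-unique : ∀ e f → Unique (triplesAt e f)
    at-unique e f with toℕ e ℕ.<ᵇ toℕ f
    ... | false = []
    ... | true = Unique.map⁺ (cong (proj₂ ∘ proj₂)) (Unique.filter⁺ (T? ∘ commonEnd e f) (Unique.allFin⁺ (n G)))
    at-keyed : ∀ e {f t} → t ∈ triplesAt e f → proj₁ (proj₂ t) ≡ f
    at-keyed e {f} t∈ with toℕ e ℕ.<ᵇ toℕ f
    ... | true with _ , _ , refl ← ∈-map⁻ (λ v → e , f , v) t∈ = refl
    keyed : ∀ {e t} → t ∈ concatMap (triplesAt e) (allFin (m G)) → proj₁ t ≡ e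
    keyed {e} t∈ with find (∈-concatMap⁻ (triplesAt e) {xs = allFin (m G)} t∈)
    ... | f , _ , t∈′ with toℕ e ℕ.<ᵇ toℕ f
    ... | false with () ← t∈′
    ... | true with _ , _ , refl ← ∈-map⁻ (λ v → e , f , v) t∈′ = refl

  contains : E → Triple → Bool
  contains e t = incidentᵇ e (edgePair t)

  ∈triples⇒≢ : ∀ {x y v} → (x , y , v) ∈ triples → x ≢ y
  ∈triples⇒≢ t∈ refl = ℕ.<-irrefl refl (proj₁ (∈-triples⁻ t∈))

  inc-meet : ∀ {e t} → t ∈ triples → T (contains e t) → T (inc (meet t) e)
  inc-meet {e} {x , y , v} t∈ c with incidentᵇ⁻ {v = e} {x} {y} c
  ... | inj₁ refl = proj₁ (proj₂ (∈-triples⁻ t∈))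
  ... | inj₂ refl = proj₂ (proj₂ (∈-triples⁻ t∈))

  other : E → Triple → E
  other e (x , y , _) = if x =ᶠ e then y else x

  other-≢ : ∀ {e t} → t ∈ triples → T (contains e t) → other e t ≢ e
  other-≢ {e} {x , y , v} t∈ c with incidentᵇ⁻ {v = e} {x} {y} c
  ... | inj₁ refl rewrite =ᶠ-≡-true x = ∈triples⇒≢ t∈ ∘ sym
  ... | inj₂ refl rewrite =ᶠ-≡-false (∈triples⇒≢ t∈) = ∈triples⇒≢ t∈

  contains-other : ∀ {e t} → t ∈ triples → T (contains e t) → T (contains (other e t) t)
  contains-other {e} {x , y , v} t∈ c with incidentᵇ⁻ {v = e} {x} {y} c
  ... | inj₁ refl rewrite =ᶠ-≡-true x = incidentᵇ-second x y
  ... | inj₂ refl rewrite =ᶠ-≡-false (∈triples⇒≢ t∈) = incidentᵇ-first x y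

  contains⇒≡∨≡other : ∀ {e z t} → t ∈ triples → T (contains e t) → T (contains z t) → z ≡ e ⊎ z ≡ other e t
  contains⇒≡∨≡other {e} {z} {x , y , v} t∈ c cz with incidentᵇ⁻ {v = e} {x} {y} c | incidentᵇ⁻ {v = z} {x} {y} cz
  ... | inj₁ refl | inj₁ refl = inj₁ refl
  ... | inj₂ refl | inj₂ refl = inj₁ refl
  ... | inj₁ refl | inj₂ refl rewrite =ᶠ-≡-true x = inj₂ refl
  ... | inj₂ refl | inj₁ refl rewrite =ᶠ-≡-false (∈triples⇒≢ t∈) = inj₂ refl

  triple : E → E → V → Triple
  triple e f w = if toℕ e ℕ.<ᵇ toℕ f then (e , f , w) else (f , e , w)

  triple-∈ : ∀ {e f w} → e ≢ f → T (inc w e) → T (inc w f) → triple e f w ∈ triples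
  triple-∈ {e} {f} e≢f we wf with toℕ e ℕ.<ᵇ toℕ f in e<f
  ... | true = ∈-triples⁺ (ℕ.<ᵇ⇒< (toℕ e) (toℕ f) (subst T (sym e<f) _)) we wf
  ... | false = ∈-triples⁺ f<e wf we
    where
    f<e : toℕ f ℕ.< toℕ e
    f<e = ℕ.≤∧≢⇒< (ℕ.≮⇒≥ (subst T e<f ∘ ℕ.<⇒<ᵇ)) (e≢f ∘ Fin.toℕ-injective ∘ sym)

  contains-triple₁ : ∀ e f w → T (contains e (triple e f w))
  contains-triple₁ e f w with toℕ e ℕ.<ᵇ toℕ f
  ... | true = incidentᵇ-first e f
  ... | false = incidentᵇ-second f e

  meet-triple : ∀ e f w → meet (triple e f w) ≡ w
  meet-triple e f w with toℕ e ℕ.<ᵇ toℕ f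
  ... | true = refl
  ... | false = refl

  ≡triple : ∀ {e f t} → t ∈ triples → T (contains e t) → T (contains f t) → e ≢ f → t ≡ triple e f (meet t)
  ≡triple {e} {f} {x , y , v} t∈ ce cf e≢f with incidentᵇ⁻ {v = e} {x} {y} ce | incidentᵇ⁻ {v = f} {x} {y} cf
  ... | inj₁ refl | inj₁ refl = ⊥-elim (e≢f refl)
  ... | inj₂ refl | inj₂ refl = ⊥-elim (e≢f refl)
  ... | inj₁ refl | inj₂ refl rewrite Equivalence.to T-≡ (ℕ.<⇒<ᵇ (proj₁ (∈-triples⁻ t∈))) = refl
  ... | inj₂ refl | inj₁ refl with toℕ y ℕ.<ᵇ toℕ x in y<x
  ...   | false = refl
  ...   | true = ⊥-elim (ℕ.<-asym (proj₁ (∈-triples⁻ t∈)) (ℕ.<ᵇ⇒< (toℕ y) (toℕ x) (subst T (sym y<x) _)))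

module _ (f : A → A) (f-involutive : ∀ x → f (f x) ≡ x) (f-fixes-nothing : ∀ x → f x ≢ x) where

  private
    f-injective : ∀ {x y} → f x ≡ f y → x ≡ y
    f-injective {x} {y} fx≡fy = trans (sym (f-involutive x)) (trans (cong f fx≡fy) (f-involutive y))

  no-involution-on-three : ∀ {a b c} → a ≢ b → a ≢ c → b ≢ c →
    (∀ {x} → x ∈ a ∷ b ∷ c ∷ [] → f x ∈ a ∷ b ∷ c ∷ []) → ⊥
  no-involution-on-three {a} {b} {c} a≢b a≢c b≢c closed with closed (here refl)
  ... | here fa≡a = f-fixes-nothing a fa≡a
  ... | there (here fa≡b) with closed (there (there (here refl)))
  ...   | here fc≡a = b≢c (f-injective (trans (cong f (sym fa≡b)) (trans (f-involutive a) (sym fc≡a))))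
  ...   | there (here fc≡b) = a≢c (f-injective (trans fa≡b (sym fc≡b)))
  ...   | there (there (here fc≡c)) = f-fixes-nothing c fc≡c
  no-involution-on-three {a} {b} {c} a≢b a≢c b≢c closed | there (there (here fa≡c)) with closed (there (here refl))
  ...   | here fb≡a = b≢c (f-injective (trans fb≡a (sym (trans (cong f (sym fa≡c)) (f-involutive a)))))
  ...   | there (here fb≡b) = f-fixes-nothing b fb≡b
  ...   | there (there (here fb≡c)) = a≢b (f-injective (trans fa≡c (sym fb≡c)))

module _ {k : ℕ} (p : Fin k → Bool) where

  private
    chosen = filterᵇ p (allFin k)

    chosen-unique : Unique chosen
    chosen-unique = Unique.filter⁺ (T? ∘ p) (Unique.allFin⁺ k)

    ∈-chosen : ∀ {x} → T (p x) → x ∈ chosen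
    ∈-chosen px = ∈-filter⁺ (T? ∘ p) (∈-allFin _) px

    chosen⇒p : ∀ {x} → x ∈ chosen → T (p x)
    chosen⇒p x∈ = proj₂ (∈-filter⁻ (T? ∘ p) {xs = allFin k} x∈)

    length-chosen : length chosen ≡ countᵇ p (allFin k)
    length-chosen = sym (countᵇ≡length-filterᵇ p (allFin k))

    ≤3⇒≢4+ : ∀ {c} → countᵇ p (allFin k) ≤ 3 → countᵇ p (allFin k) ≢ 4 ℕ.+ c
    ≤3⇒≢4+ ≤3 c≡4+ = ℕ.≤⇒≯ ≤3 (subst (3 ℕ.<_) (sym c≡4+) (s≤s (s≤s (s≤s (s≤s z≤n)))))

  countᵇ≤3-involution⇒even : (f : Fin k → Fin k) → (∀ x → f (f x) ≡ x) → (∀ x → f x ≢ x) →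
    (∀ {x} → T (p x) → T (p (f x))) → countᵇ p (allFin k) ≤ 3 → T (evenᵇ (countᵇ p (allFin k)))
  countᵇ≤3-involution⇒even f f-involutive f-fixes-nothing p⇒pf ≤3 = go _ refl
    where
    go : ∀ c → countᵇ p (allFin k) ≡ c → T (evenᵇ c)
    go 0 _ = _
    go 2 _ = _
    go 1 c≡1 with x , _ , px ← countᵇ≡suc⇒∃ p (allFin k) c≡1 =
      f-fixes-nothing x (countᵇ≡1⇒unique p c≡1 (∈-allFin (f x)) (∈-allFin x) (p⇒pf px) px)
    go 3 c≡3 with chosen | chosen-unique | trans length-chosen c≡3 | ∈-chosen | chosen⇒p
    ... | a ∷ b ∷ c ∷ [] | (a∉ ∷ b∉ ∷ _) | _ | ∈-abc | abc⇒p =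
      no-involution-on-three f f-involutive f-fixes-nothing (All.lookup a∉ (here refl)) (All.lookup a∉ (there (here refl)))
        (All.lookup b∉ (here refl)) (∈-abc ∘ p⇒pf ∘ abc⇒p)
    go (suc (suc (suc (suc c)))) c≡4+ = ⊥-elim (≤3⇒≢4+ ≤3 c≡4+)

  countᵇ-even≤3⇒companion : T (evenᵇ (countᵇ p (allFin k))) → countᵇ p (allFin k) ≤ 3 →
    ∀ {e} → T (p e) → ∃[ f ] (f ≢ e × T (p f) × (∀ {z} → T (p z) → z ≡ e ⊎ z ≡ f))
  countᵇ-even≤3⇒companion even ≤3 {e} pe = go _ refl even
    where
    go : ∀ c → countᵇ p (allFin k) ≡ c → T (evenᵇ c) →
      ∃[ f ] (f ≢ e × T (p f) × (∀ {z} → T (p z) → z ≡ e ⊎ z ≡ f))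
    go 0 c≡0 _ = ⊥-elim (countᵇ≡0⇒¬ p c≡0 (∈-allFin e) pe)
    go 2 c≡2 _ with chosen | chosen-unique | trans length-chosen c≡2 | ∈-chosen | chosen⇒p
    ... | a ∷ b ∷ [] | (a∉ ∷ _) | _ | ∈-ab | ab⇒p with ∈-ab pe
    ...   | here refl =
      b , (λ b≡a → All.lookup a∉ (here refl) (sym b≡a)) , ab⇒p (there (here refl)) , λ pz → case (∈-ab pz)
      where
      case : ∀ {z} → z ∈ a ∷ b ∷ [] → z ≡ a ⊎ z ≡ b
      case (here z≡a) = inj₁ z≡a
      case (there (here z≡b)) = inj₂ z≡b
    ...   | there (here refl) = a , All.lookup a∉ (here refl) , ab⇒p (here refl) , λ pz → case (∈-ab pz)
      where
      case : ∀ {z} → z ∈ a ∷ b ∷ [] → z ≡ b ⊎ z ≡ a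
      case (here z≡a) = inj₂ z≡a
      case (there (here z≡b)) = inj₁ z≡b
    go (suc (suc (suc (suc c)))) c≡4+ _ = ⊥-elim (≤3⇒≢4+ ≤3 c≡4+)

-- Perfect matchings of L(G) and orientations with even in-degrees

module Orientations (G : Multigraph) where

  open Incidence G

  head : List Bool → E → V
  head os e = if os ‼ e then end₁ e else end₂ e

  inc-head : ∀ os e → T (inc (head os e) e)
  inc-head os e with os ‼ e
  ... | true = inc-end₁ e
  ... | false = inc-end₂ e

  indegree : List Bool → V → ℕ
  indegree os v = countᵇ (λ e → head os e =ᶠ v) (allFin (m G))

  isEvenᵇ : List Bool → Bool
  isEvenᵇ os = allᵇ (λ v → evenᵇ (indegree os v)) (allFin (n G))

  countᵇ-at≤degree : (h : E → V) → (∀ e → T (inc (h e) e)) →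
    ∀ v → countᵇ (λ e → h e =ᶠ v) (allFin (m G)) ≤ degree G v
  countᵇ-at≤degree h inc-h v =
    countᵇ-mono (λ {e} he=v → subst (λ w → T (inc w e)) (=ᶠ⇒≡ {a = h e} {b = v} he=v) (inc-h e)) (allFin (m G))

  no-four-edges-at : Cubic G → ∀ {v a b c d} → T (inc v a) → T (inc v b) → T (inc v c) → T (inc v d) →
    a ≢ b → a ≢ c → a ≢ d → b ≢ c → b ≢ d → c ≢ d → ⊥
  no-four-edges-at cubic {v} {a} {b} {c} {d} va vb vc vd a≢b a≢c a≢d b≢c b≢d c≢d =
    ℕ.≤⇒≯ (ℕ.≤-reflexive (trans (sym (countᵇ≡length-filterᵇ (inc v) (allFin (m G)))) (cubic v)))
          (unique-⊆⇒length≤ abcd-unique abcd⊆)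
    where
    abcd-unique : Unique (a ∷ b ∷ c ∷ d ∷ [])
    abcd-unique =
      (a≢b All.∷ a≢c All.∷ a≢d All.∷ All.[]) ∷ (b≢c All.∷ b≢d All.∷ All.[]) ∷ (c≢d All.∷ All.[]) ∷ All.[] ∷ []
    abcd⊆ : ∀ {x} → x ∈ a ∷ b ∷ c ∷ d ∷ [] → x ∈ filterᵇ (inc v) (allFin (m G))
    abcd⊆ (here refl) = ∈-filter⁺ (T? ∘ inc v) (∈-allFin a) va
    abcd⊆ (there (here refl)) = ∈-filter⁺ (T? ∘ inc v) (∈-allFin b) vb
    abcd⊆ (there (there (here refl))) = ∈-filter⁺ (T? ∘ inc v) (∈-allFin c) vc
    abcd⊆ (there (there (there (here refl)))) = ∈-filter⁺ (T? ∘ inc v) (∈-allFin d) vd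

module MatchingsAsOrientations (G : Multigraph) (loopless : Loopless G) (cubic : Cubic G) where

  open Incidence G
  open LineGraphTriples G
  open Orientations G

  Covers : List Triple → Set
  Covers S = ∀ e → countᵇ (contains e) S ≡ 1

  isPerfectMatchingᵇ⇔Covers : ∀ bs → T (isPerfectMatchingᵇ (LineGraph G) bs) ⇔ Covers (select bs triples)
  isPerfectMatchingᵇ⇔Covers bs = mk⇔
    (λ pm e → trans (sym (count-at e)) (ℕ.≡ᵇ⇒≡ _ 1 (allᵇ⁻ _ (allFin (m G)) pm (∈-allFin e))))
    (λ covers → allᵇ⁺ _ (allFin (m G)) λ {e} _ → ℕ.≡⇒≡ᵇ _ 1 (trans (count-at e) (covers e)))
    where
    count-at : ∀ e → countᵇ (incidentᵇ e) (selected (LineGraph G) bs) ≡ countᵇ (contains e) (select bs triples)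
    count-at e = trans (cong (countᵇ (incidentᵇ e)) (selected-lineGraph bs))
                       (countᵇ-map (incidentᵇ e) edgePair (select bs triples))

  marks : E → Triple → Bool
  marks e t = contains e t ∧ (meet t =ᶠ end₁ e)

  toOrientation : List Bool → List Bool
  toOrientation bs = tabulate (λ e → any (marks e) (select bs triples))

  bothPointToMeet : List Bool → Triple → Bool
  bothPointToMeet os (e , f , v) = (head os e =ᶠ v) ∧ (head os f =ᶠ v)

  toMatching : List Bool → List Bool
  toMatching os = map (bothPointToMeet os) triples

  head-toOrientation : ∀ bs e {t w} → t ∈ select bs triples → T (contains e t) → meet t ≡ w →
    (∀ {t′} → t′ ∈ select bs triples → T (contains e t′) → meet t′ ≡ w) → head (toOrientation bs) e ≡ w
  head-toOrientation bs e {t} {w} t∈ ct meet≡w meets≡w =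
    trans (cong (λ b → if b then end₁ e else end₂ e) (tabulate-‼ _ e)) (pick (incidentᵇ⁻ inc-w))
    where
    S = select bs triples
    inc-w : T (inc w e)
    inc-w = subst (λ u → T (inc u e)) meet≡w (inc-meet (select-⊆ bs triples t∈) ct)
    t-marked : w ≡ end₁ e → T (marks e t)
    t-marked w≡end₁ = Equivalence.from T-∧ (ct , ≡⇒=ᶠ (trans meet≡w w≡end₁))
    pick : w ≡ end₁ e ⊎ w ≡ end₂ e → (if any (marks e) S then end₁ e else end₂ e) ≡ w
    pick (inj₁ w≡end₁) rewrite Equivalence.to T-≡ (any⁺ (marks e) (lose t∈ (t-marked w≡end₁))) = sym w≡end₁
    pick (inj₂ w≡end₂) with any (marks e) S in marked
    ... | false = sym w≡end₂
    ... | true with t′ , t′∈ , m ← find (any⁻ (marks e) S (subst T (sym marked) _)) =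
      let ct′ , meet=end₁ = Equivalence.to T-∧ m
      in ⊥-elim (loopless e (trans (sym (=ᶠ⇒≡ meet=end₁)) (trans (meets≡w t′∈ ct′) w≡end₂)))

  head≡⇒‼≡ : ∀ os os′ e → head os e ≡ head os′ e → os ‼ e ≡ os′ ‼ e
  head≡⇒‼≡ os os′ e eq with os ‼ e | os′ ‼ e
  ... | true | true = refl
  ... | false | false = refl
  ... | true | false = ⊥-elim (loopless e eq)
  ... | false | true = ⊥-elim (loopless e (sym eq))

  module FromMatching (bs : List Bool) (covers : Covers (select bs triples)) where

    S = select bs triples

    S⊆triples : ∀ {t} → t ∈ S → t ∈ triples
    S⊆triples = select-⊆ bs triples

    tripleOf-spec : ∀ e → ∃[ t ] (t ∈ S × T (contains e t))
    tripleOf-spec e = countᵇ≡suc⇒∃ (contains e) S (covers e)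

    tripleOf : E → Triple
    tripleOf e = proj₁ (tripleOf-spec e)

    tripleOf-∈ : ∀ e → tripleOf e ∈ S
    tripleOf-∈ e = proj₁ (proj₂ (tripleOf-spec e))

    tripleOf-∈triples : ∀ e → tripleOf e ∈ triples
    tripleOf-∈triples e = S⊆triples (tripleOf-∈ e)

    contains-tripleOf : ∀ e → T (contains e (tripleOf e))
    contains-tripleOf e = proj₂ (proj₂ (tripleOf-spec e))

    tripleOf-unique : ∀ {e t} → t ∈ S → T (contains e t) → t ≡ tripleOf e
    tripleOf-unique {e} t∈ ct = countᵇ≡1⇒unique (contains e) (covers e) t∈ (tripleOf-∈ e) ct (contains-tripleOf e)

    meetOf : E → V
    meetOf e = meet (tripleOf e)

    inc-meetOf : ∀ e → T (inc (meetOf e) e)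
    inc-meetOf e = inc-meet (tripleOf-∈triples e) (contains-tripleOf e)

    partner : E → E
    partner e = other e (tripleOf e)

    partner-≢ : ∀ e → partner e ≢ e
    partner-≢ e = other-≢ (tripleOf-∈triples e) (contains-tripleOf e)

    tripleOf-partner : ∀ e → tripleOf (partner e) ≡ tripleOf e
    tripleOf-partner e = sym (tripleOf-unique (tripleOf-∈ e) (contains-other (tripleOf-∈triples e) (contains-tripleOf e)))

    partner-involutive : ∀ e → partner (partner e) ≡ e
    partner-involutive e
      with contains⇒≡∨≡other (tripleOf-∈triples e) (contains-other (tripleOf-∈triples e) (contains-tripleOf e))
                             (contains-tripleOf e)
    ... | inj₁ e≡partner = ⊥-elim (partner-≢ e (sym e≡partner))
    ... | inj₂ e≡other = trans (cong (other (partner e)) (tripleOf-partner e)) (sym e≡other)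

    head-toOrientation≡meetOf : ∀ e → head (toOrientation bs) e ≡ meetOf e
    head-toOrientation≡meetOf e =
      head-toOrientation bs e (tripleOf-∈ e) (contains-tripleOf e) refl (λ t∈ ct → cong meet (tripleOf-unique t∈ ct))

    toOrientation-even : T (isEvenᵇ (toOrientation bs))
    toOrientation-even = allᵇ⁺ _ (allFin (n G)) λ {v} _ →
      subst (T ∘ evenᵇ) (sym (countᵇ-cong-local (allFin (m G)) (λ {e} _ → cong (_=ᶠ v) (head-toOrientation≡meetOf e))))
        (countᵇ≤3-involution⇒even (λ e → meetOf e =ᶠ v) partner partner-involutive partner-≢
          (subst (λ u → T (u =ᶠ v)) (sym (cong meet (tripleOf-partner _))))
          (subst (countᵇ (λ e → meetOf e =ᶠ v) (allFin (m G)) ≤_) (cubic v) (countᵇ-at≤degree meetOf inc-meetOf v)))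

    -- Two edges at v lying in different triples of S would, with their partners, be four edges at v.
    distinct-triplesAt⇒⊥ : ∀ {x y v} → T (inc v x) → T (inc v y) → x ≢ y → meetOf x ≡ v → meetOf y ≡ v →
      tripleOf x ≢ tripleOf y → ⊥
    distinct-triplesAt⇒⊥ {x} {y} {v} vx vy x≢y mx my tx≢ty =
      no-four-edges-at cubic {v} vx vy (partner-at x mx) (partner-at y my)
        x≢y (partner-≢ x ∘ sym) (λ x≡py → tx≢ty (trans (cong tripleOf x≡py) (tripleOf-partner y)))
        (λ y≡px → tx≢ty (sym (trans (cong tripleOf y≡px) (tripleOf-partner x)))) (partner-≢ y ∘ sym)
        (λ px≡py → tx≢ty (trans (sym (tripleOf-partner x)) (trans (cong tripleOf px≡py) (tripleOf-partner y))))
      where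
      partner-at : ∀ e {v} → meetOf e ≡ v → T (inc v (partner e))
      partner-at e me =
        subst (λ u → T (inc u (partner e))) (trans (cong meet (tripleOf-partner e)) me) (inc-meetOf (partner e))

    toMatching-toOrientation : length bs ≡ length triples → toMatching (toOrientation bs) ≡ bs
    toMatching-toOrientation len = map≡ᵇselect (bothPointToMeet os) bs len triples-unique both⇒selected selected⇒both
      where
      os = toOrientation bs
      meets : ∀ e {v} → T (head os e =ᶠ v) → meetOf e ≡ v
      meets e he = trans (sym (head-toOrientation≡meetOf e)) (=ᶠ⇒≡ he)
      selected⇒both : ∀ {t} → t ∈ S → T (bothPointToMeet os t)
      selected⇒both {x , y , v} t∈ = Equivalence.from T-∧ (points x (incidentᵇ-first x y) , points y (incidentᵇ-second x y))
        where
        points : ∀ e → T (contains e (x , y , v)) → T (head os e =ᶠ v)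
        points e ce = ≡⇒=ᶠ (trans (head-toOrientation≡meetOf e) (sym (cong meet (tripleOf-unique t∈ ce))))
      both⇒selected : ∀ {t} → t ∈ triples → T (bothPointToMeet os t) → t ∈ S
      both⇒selected {x , y , v} t∈ both with contains y (tripleOf x) in cy
      ... | true = subst (_∈ S) (sym t≡tripleOf) (tripleOf-∈ x)
        where
        x≢y = ∈triples⇒≢ t∈
        t≡tripleOf : (x , y , v) ≡ tripleOf x
        t≡tripleOf = trans (≡triple t∈ (incidentᵇ-first x y) (incidentᵇ-second x y) x≢y)
          (sym (trans (≡triple (tripleOf-∈triples x) (contains-tripleOf x) (subst T (sym cy) _) x≢y)
                      (cong (triple x y) (meets x (proj₁ (Equivalence.to T-∧ both))))))
      ... | false = ⊥-elim (distinct-triplesAt⇒⊥ vx vy (∈triples⇒≢ t∈) (meets x (proj₁ pts)) (meets y (proj₂ pts))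
                      λ tx≡ty → subst T cy (subst (T ∘ contains y) (sym tx≡ty) (contains-tripleOf y)))
        where
        pts = Equivalence.to (T-∧ {head os x =ᶠ v}) both
        vx = proj₁ (proj₂ (∈-triples⁻ t∈))
        vy = proj₂ (proj₂ (∈-triples⁻ t∈))

  bothPointToMeet-triple : ∀ os {e f w} → head os e ≡ w → head os f ≡ w → T (bothPointToMeet os (triple e f w))
  bothPointToMeet-triple os {e} {f} {w} he hf with toℕ e ℕ.<ᵇ toℕ f
  ... | true = Equivalence.from T-∧ (≡⇒=ᶠ he , ≡⇒=ᶠ hf)
  ... | false = Equivalence.from T-∧ (≡⇒=ᶠ hf , ≡⇒=ᶠ he)

  module FromOrientation (os : List Bool) (even : T (isEvenᵇ os)) where

    partner-spec : ∀ e →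
      ∃[ f ] (f ≢ e × T (head os f =ᶠ head os e) × (∀ {z} → T (head os z =ᶠ head os e) → z ≡ e ⊎ z ≡ f))
    partner-spec e =
      countᵇ-even≤3⇒companion (λ z → head os z =ᶠ w) (allᵇ⁻ _ (allFin (n G)) even (∈-allFin w))
        (subst (countᵇ (λ z → head os z =ᶠ w) (allFin (m G)) ≤_) (cubic w) (countᵇ-at≤degree (head os) (inc-head os) w))
        (=ᶠ-refl w)
      where w = head os e

    partner : E → E
    partner e = proj₁ (partner-spec e)

    partner-≢ : ∀ e → partner e ≢ e
    partner-≢ e = proj₁ (proj₂ (partner-spec e))

    head-partner : ∀ e → head os (partner e) ≡ head os e
    head-partner e = =ᶠ⇒≡ (proj₁ (proj₂ (proj₂ (partner-spec e))))

    partner-unique : ∀ {e z} → head os z ≡ head os e → z ≡ e ⊎ z ≡ partner e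
    partner-unique {e} hz = proj₂ (proj₂ (proj₂ (partner-spec e))) (≡⇒=ᶠ hz)

    S = filterᵇ (bothPointToMeet os) triples

    S⇒both : ∀ {t} → t ∈ S → t ∈ triples × T (bothPointToMeet os t)
    S⇒both = ∈-filter⁻ (T? ∘ bothPointToMeet os) {xs = triples}

    select-toMatching : select (toMatching os) triples ≡ S
    select-toMatching = select-by-map (bothPointToMeet os) triples

    tripleAt : E → Triple
    tripleAt e = triple e (partner e) (head os e)

    tripleAt-∈ : ∀ e → tripleAt e ∈ S
    tripleAt-∈ e = ∈-filter⁺ (T? ∘ bothPointToMeet os)
      (triple-∈ (partner-≢ e ∘ sym) (inc-head os e)
                (subst (λ u → T (inc u (partner e))) (head-partner e) (inc-head os (partner e))))
      (bothPointToMeet-triple os refl (head-partner e))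

    head≡meet : ∀ {e t} → t ∈ S → T (contains e t) → head os e ≡ meet t
    head≡meet {e} {x , y , v} t∈ ce
      with Equivalence.to (T-∧ {head os x =ᶠ v}) (proj₂ (S⇒both t∈)) | incidentᵇ⁻ {v = e} {x} {y} ce
    ... | hx , _ | inj₁ refl = =ᶠ⇒≡ {a = head os x} hx
    ... | _ , hy | inj₂ refl = =ᶠ⇒≡ {a = head os y} hy

    tripleAt-unique : ∀ {e t} → t ∈ S → T (contains e t) → t ≡ tripleAt e
    tripleAt-unique {e} {t} t∈ ce with t∈T , _ ← S⇒both t∈
      with partner-unique {e} (trans (head≡meet t∈ (contains-other t∈T ce)) (sym (head≡meet t∈ ce)))
    ... | inj₁ other≡e = ⊥-elim (other-≢ t∈T ce other≡e)
    ... | inj₂ other≡partner =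
      trans (≡triple t∈T ce (subst (λ f → T (contains f t)) other≡partner (contains-other t∈T ce)) (partner-≢ e ∘ sym))
            (cong (triple e (partner e)) (sym (head≡meet t∈ ce)))

    toMatching-covers : Covers (select (toMatching os) triples)
    toMatching-covers e rewrite select-toMatching =
      countᵇ≡1 (contains e) (Unique.filter⁺ (T? ∘ bothPointToMeet os) triples-unique) (tripleAt-∈ e)
        (contains-triple₁ e (partner e) (head os e)) tripleAt-unique

    toOrientation-toMatching : length os ≡ m G → toOrientation (toMatching os) ≡ os
    toOrientation-toMatching len = trans (tabulate-cong bit≡) (‼-tabulate (m G) os len)
      where
      head≡ : ∀ e → head (toOrientation (toMatching os)) e ≡ head os e
      head≡ e = head-toOrientation (toMatching os) e (subst (tripleAt e ∈_) (sym select-toMatching) (tripleAt-∈ e))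
        (contains-triple₁ e (partner e) (head os e)) (meet-triple e (partner e) (head os e))
        (λ t∈ ct → sym (head≡meet (subst (_ ∈_) select-toMatching t∈) ct))
      bit≡ : ∀ e → any (marks e) (select (toMatching os) triples) ≡ os ‼ e
      bit≡ e = trans (sym (tabulate-‼ _ e)) (head≡⇒‼≡ (toOrientation (toMatching os)) os e (head≡ e))

  M≡countᵇ-isEvenᵇ : M (LineGraph G) ≡ countᵇ isEvenᵇ (subsets (m G))
  M≡countᵇ-isEvenᵇ =
    countᵇ-bijection (subsets-unique (length (lineEdges G))) (subsets-unique (m G)) toOrientation toMatching
      (λ {bs} _ pm → ∈-subsets⁺ (m G) (length-tabulate _) , FromMatching.toOrientation-even bs (covers {bs} pm))
      (λ {os} _ even → ∈-subsets⁺ _ (trans (length-map _ triples) (sym length-lineEdges)) ,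
                       Equivalence.from (isPerfectMatchingᵇ⇔Covers (toMatching os))
                                        (FromOrientation.toMatching-covers os even))
      (λ {bs} bs∈ pm → FromMatching.toMatching-toOrientation bs (covers {bs} pm)
                         (trans (∈-subsets⁻ _ bs∈) length-lineEdges))
      (λ {os} os∈ even → FromOrientation.toOrientation-toMatching os even (∈-subsets⁻ (m G) os∈))
    where
    covers : ∀ {bs} → T (isPerfectMatchingᵇ (LineGraph G) bs) → Covers (select bs triples)
    covers {bs} = Equivalence.to (isPerfectMatchingᵇ⇔Covers bs)
    length-lineEdges : length (lineEdges G) ≡ length triples
    length-lineEdges = trans (cong length lineEdges≡) (length-map edgePair triples)

-- Counting orientations with even in-degrees

‼-constant⇒replicate : ∀ k {bs c} → length bs ≡ k → (∀ (i : Fin k) → bs ‼ i ≡ c) → bs ≡ replicate k c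
‼-constant⇒replicate zero {[]} _ _ = refl
‼-constant⇒replicate (suc k) {b ∷ bs} len constant =
  cong₂ _∷_ (constant zero) (‼-constant⇒replicate k (ℕ.suc-injective len) (constant ∘ suc))

module EvenOrientationCount (G : Multigraph) where

  open import Data.Integer using (ℤ; +_; -_; _+_; _*_; _^_; 0ℤ; 1ℤ; -1ℤ)

  open Incidence G
  open Orientations G

  σ : List Bool → V → ℤ
  σ S v = if S ‼ v then -1ℤ else 1ℤ

  evenness-as-∏ : ∀ os → (+ 2) ^ n G * χ (isEvenᵇ os) ≡ ∏[ v ∈ allFin (n G) ] (1ℤ + -1ℤ ^ indegree os v)
  evenness-as-∏ os = begin
    (+ 2) ^ n G * χ (isEvenᵇ os)
      ≡⟨ cong₂ _*_ (trans (cong ((+ 2) ^_) (sym (length-allFin (n G)))) (sym (∏-const (allFin (n G)) (+ 2))))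
                   (χ-allᵇ (λ v → evenᵇ (indegree os v)) (allFin (n G))) ⟩
    (∏[ v ∈ allFin (n G) ] + 2) * (∏[ v ∈ allFin (n G) ] χ (evenᵇ (indegree os v)))
      ≡⟨ ∏.fold-∙ (allFin (n G)) _ _ ⟨
    ∏[ v ∈ allFin (n G) ] (+ 2 * χ (evenᵇ (indegree os v)))
      ≡⟨ ∏.fold-cong-local (allFin (n G)) (λ {v} _ → 2χ-evenᵇ (indegree os v)) ⟩
    ∏[ v ∈ allFin (n G) ] (1ℤ + -1ℤ ^ indegree os v) ∎
    where open ≡-Reasoning

  ∏-sign-on≡∏-σ-head : ∀ os S →
    ∏[ v ∈ allFin (n G) ] (if S ‼ v then -1ℤ ^ indegree os v else 1ℤ) ≡ ∏[ e ∈ allFin (m G) ] σ S (head os e)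
  ∏-sign-on≡∏-σ-head os S = begin
    ∏[ v ∈ allFin (n G) ] (if S ‼ v then -1ℤ ^ indegree os v else 1ℤ)
      ≡⟨ ∏.fold-cong-local (allFin (n G)) (λ {v} _ → trans (cong (if S ‼ v then_else 1ℤ) (-1^countᵇ _ (allFin (m G))))
                                                           (if-then-∏ (S ‼ v) (allFin (m G)) _)) ⟩
    ∏[ v ∈ allFin (n G) ] ∏[ e ∈ allFin (m G) ] (if S ‼ v then (if head os e =ᶠ v then -1ℤ else 1ℤ) else 1ℤ)
      ≡⟨ ∏.fold-comm (allFin (n G)) (allFin (m G)) _ ⟩
    ∏[ e ∈ allFin (m G) ] ∏[ v ∈ allFin (n G) ] (if S ‼ v then (if head os e =ᶠ v then -1ℤ else 1ℤ) else 1ℤ)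
      ≡⟨ ∏.fold-cong-local (allFin (m G)) (λ {e} _ →
           trans (∏.fold-cong-local (allFin (n G)) (λ {v} _ → if-swap-then (S ‼ v) (head os e =ᶠ v)))
                 (∏.fold-point Fin._≟_ (Unique.allFin⁺ (n G)) (∈-allFin (head os e)) (σ S))) ⟩
    ∏[ e ∈ allFin (m G) ] σ S (head os e) ∎
    where open ≡-Reasoning

  count·2^n≡∑∑∏σ : + countᵇ isEvenᵇ (subsets (m G)) * (+ 2) ^ n G
                  ≡ ∑[ S ∈ subsets (n G) ] ∑[ os ∈ subsets (m G) ] ∏[ e ∈ allFin (m G) ] σ S (head os e)
  count·2^n≡∑∑∏σ = begin
    + countᵇ isEvenᵇ Y * (+ 2) ^ n G
      ≡⟨ ℤ.*-comm _ ((+ 2) ^ n G) ⟩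
    (+ 2) ^ n G * + countᵇ isEvenᵇ Y
      ≡⟨ cong ((+ 2) ^ n G *_) (countᵇ≡∑χ isEvenᵇ Y) ⟩
    (+ 2) ^ n G * (∑[ os ∈ Y ] χ (isEvenᵇ os))
      ≡⟨ ∑-*ˡ ((+ 2) ^ n G) Y _ ⟨
    ∑[ os ∈ Y ] ((+ 2) ^ n G * χ (isEvenᵇ os))
      ≡⟨ ∑.fold-cong-local Y (λ {os} _ → trans (evenness-as-∏ os) (expand os)) ⟩
    ∑[ os ∈ Y ] ∑[ S ∈ Z ] ∏[ v ∈ allFin (n G) ] (if S ‼ v then -1ℤ ^ indegree os v else 1ℤ)
      ≡⟨ ∑.fold-comm Y Z _ ⟩
    ∑[ S ∈ Z ] ∑[ os ∈ Y ] ∏[ v ∈ allFin (n G) ] (if S ‼ v then -1ℤ ^ indegree os v else 1ℤ)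
      ≡⟨ ∑.fold-cong-local Z (λ {S} _ → ∑.fold-cong-local Y (λ {os} _ → ∏-sign-on≡∏-σ-head os S)) ⟩
    ∑[ S ∈ Z ] ∑[ os ∈ Y ] ∏[ e ∈ allFin (m G) ] σ S (head os e) ∎
    where
    open ≡-Reasoning
    Y = subsets (m G)
    Z = subsets (n G)
    expand : ∀ os → ∏[ v ∈ allFin (n G) ] (1ℤ + -1ℤ ^ indegree os v)
                  ≡ ∑[ S ∈ Z ] ∏[ v ∈ allFin (n G) ] (if S ‼ v then -1ℤ ^ indegree os v else 1ℤ)
    expand os = trans (∏.fold-cong-local (allFin (n G)) (λ {v} _ → ℤ.+-comm 1ℤ (-1ℤ ^ indegree os v)))
                      (sym (∑-subsets-∏ (n G) (λ v b → if b then -1ℤ ^ indegree os v else 1ℤ)))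

  σ+σ≡0 : ∀ S {a b} → S ‼ a ≢ S ‼ b → σ S a + σ S b ≡ 0ℤ
  σ+σ≡0 S {a} {b} differ with S ‼ a | S ‼ b
  ... | true | true = ⊥-elim (differ refl)
  ... | true | false = refl
  ... | false | true = refl
  ... | false | false = ⊥-elim (differ refl)

  constant-along-walks : ∀ S → (∀ e → S ‼ end₁ e ≡ S ‼ end₂ e) →
    ∀ {u v} → Star (Adjacent G) u v → S ‼ u ≡ S ‼ v
  constant-along-walks S constant ε = refl
  constant-along-walks S constant ((e , inj₁ refl) ◅ walk) = trans (constant e) (constant-along-walks S constant walk)
  constant-along-walks S constant ((e , inj₂ refl) ◅ walk) = trans (sym (constant e)) (constant-along-walks S constant walk)

  _≟ᴸ_ : DecidableEquality (List Bool)
  _≟ᴸ_ = Listₚ.≡-dec Bool._≟_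

  onConstants : List Bool → ℤ
  onConstants S = (if does (replicate (n G) true ≟ᴸ S) then (+ 2) ^ m G else 0ℤ)
                + (if does (replicate (n G) false ≟ᴸ S) then (+ 2) ^ m G else 0ℤ)

  module _ (connected : Connected G) (m-even : 2 ∣ m G) where

    private
      constants-differ : replicate (n G) true ≢ replicate (n G) false
      constants-differ with n G | proj₁ connected
      ... | suc _ | _ = λ ()

    ∏-ends-replicate : ∀ c → ∏[ e ∈ allFin (m G) ] (σ (replicate (n G) c) (end₁ e) + σ (replicate (n G) c) (end₂ e))
                             ≡ onConstants (replicate (n G) c)
    ∏-ends-replicate c = trans (∏.fold-cong-local (allFin (m G)) (λ {e} _ →
        cong₂ (λ a b → (if a then -1ℤ else 1ℤ) + (if b then -1ℤ else 1ℤ))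
              (replicate-‼ c (end₁ e)) (replicate-‼ c (end₂ e))))
      (trans (∏-const (allFin (m G)) _) (trans (cong (_ ^_) (length-allFin (m G))) (value c)))
      where
      q = _∣_.quotient m-even
      m≡2q : m G ≡ 2 ℕ.* q
      m≡2q = trans (_∣_.equality m-even) (ℕ.*-comm q 2)
      c₂ = (+ 2) ^ m G
      allTrue = replicate (n G) true
      allFalse = replicate (n G) false
      value : ∀ b → ((if b then -1ℤ else 1ℤ) + (if b then -1ℤ else 1ℤ)) ^ m G ≡ onConstants (replicate (n G) b)
      value true = begin
        (- + 2) ^ m G         ≡⟨ cong ((- + 2) ^_) m≡2q ⟩
        (- + 2) ^ (2 ℕ.* q)   ≡⟨ -2^even q ⟩
        (+ 2) ^ (2 ℕ.* q)     ≡⟨ cong ((+ 2) ^_) m≡2q ⟨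
        c₂                    ≡⟨ ℤ.+-identityʳ c₂ ⟨
        c₂ + 0ℤ               ≡⟨ cong₂ _+_ (cong (if_then c₂ else 0ℤ) (dec-true (allTrue ≟ᴸ allTrue) refl))
                                           (cong (if_then c₂ else 0ℤ)
                                                 (dec-false (allFalse ≟ᴸ allTrue) (constants-differ ∘ sym))) ⟨
        onConstants (replicate (n G) true) ∎
        where open ≡-Reasoning
      value false = begin
        c₂                    ≡⟨ ℤ.+-identityˡ c₂ ⟨
        0ℤ + c₂               ≡⟨ cong₂ _+_ (cong (if_then c₂ else 0ℤ) (dec-false (allTrue ≟ᴸ allFalse) constants-differ))
                                           (cong (if_then c₂ else 0ℤ) (dec-true (allFalse ≟ᴸ allFalse) refl)) ⟨
        onConstants (replicate (n G) false) ∎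
        where open ≡-Reasoning

    v₀ : V
    v₀ = fromℕ< (proj₁ connected)

    ∏-ends : ∀ S → length S ≡ n G → ∏[ e ∈ allFin (m G) ] (σ S (end₁ e) + σ S (end₂ e)) ≡ onConstants S
    ∏-ends S len with Fin.all? (λ e → S ‼ end₁ e Bool.≟ S ‼ end₂ e)
    ... | yes constant =
      subst (λ S → ∏[ e ∈ allFin (m G) ] (σ S (end₁ e) + σ S (end₂ e)) ≡ onConstants S) (sym S≡replicate)
        (∏-ends-replicate (S ‼ v₀))
      where
      S≡replicate : S ≡ replicate (n G) (S ‼ v₀)
      S≡replicate = ‼-constant⇒replicate (n G) len (λ v → constant-along-walks S constant (proj₂ connected v v₀))
    ... | no non-constant with e , differ ← Fin.¬∀⟶∃¬ (m G) _ (λ e → S ‼ end₁ e Bool.≟ S ‼ end₂ e) non-constant =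
      trans (∏-zero (allFin (m G)) _ (∈-allFin e) (σ+σ≡0 S differ))
            (sym (cong₂ _+_ (cong (if_then _ else 0ℤ) (dec-false (_ ≟ᴸ S) (not-constant true)))
                            (cong (if_then _ else 0ℤ) (dec-false (_ ≟ᴸ S) (not-constant false)))))
      where
      not-constant : ∀ c → replicate (n G) c ≢ S
      not-constant c refl = differ (trans (replicate-‼ c (end₁ e)) (sym (replicate-‼ c (end₂ e))))

    ∑∑∏σ≡2^m+2^m : ∑[ S ∈ subsets (n G) ] ∑[ os ∈ subsets (m G) ] ∏[ e ∈ allFin (m G) ] σ S (head os e)
                   ≡ (+ 2) ^ m G + (+ 2) ^ m G
    ∑∑∏σ≡2^m+2^m = begin
      ∑[ S ∈ Z ] ∑[ os ∈ subsets (m G) ] ∏[ e ∈ allFin (m G) ] σ S (head os e)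
        ≡⟨ ∑.fold-cong-local Z (λ {S} S∈ → trans (∑-subsets-∏ (m G) (λ e b → σ S (if b then end₁ e else end₂ e)))
                                                  (∏-ends S (∈-subsets⁻ (n G) S∈))) ⟩
      ∑[ S ∈ Z ] onConstants S
        ≡⟨ ∑.fold-∙ Z _ _ ⟩
      (∑[ S ∈ Z ] (if does (replicate (n G) true ≟ᴸ S) then (+ 2) ^ m G else 0ℤ)) +
      (∑[ S ∈ Z ] (if does (replicate (n G) false ≟ᴸ S) then (+ 2) ^ m G else 0ℤ))
        ≡⟨ cong₂ _+_ (∑.fold-point _≟ᴸ_ (subsets-unique (n G)) (constant∈Z true) (λ _ → (+ 2) ^ m G))
                     (∑.fold-point _≟ᴸ_ (subsets-unique (n G)) (constant∈Z false) (λ _ → (+ 2) ^ m G)) ⟩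
      (+ 2) ^ m G + (+ 2) ^ m G ∎
      where
      open ≡-Reasoning
      Z = subsets (n G)
      constant∈Z : ∀ c → replicate (n G) c ∈ Z
      constant∈Z c = ∈-subsets⁺ (n G) (Listₚ.length-replicate (n G))

    count·2^n≡2^m+2^m : countᵇ isEvenᵇ (subsets (m G)) ℕ.* 2 ℕ.^ n G ≡ 2 ℕ.^ m G ℕ.+ 2 ℕ.^ m G
    count·2^n≡2^m+2^m = ℤ.+-injective (begin
      + (countᵇ isEvenᵇ (subsets (m G)) ℕ.* 2 ℕ.^ n G)    ≡⟨ ℤ.pos-* (countᵇ isEvenᵇ (subsets (m G))) (2 ℕ.^ n G) ⟩
      + countᵇ isEvenᵇ (subsets (m G)) * + (2 ℕ.^ n G)    ≡⟨ cong (+ countᵇ isEvenᵇ (subsets (m G)) *_) (pos-^ 2 (n G)) ⟩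
      + countᵇ isEvenᵇ (subsets (m G)) * (+ 2) ^ n G      ≡⟨ trans count·2^n≡∑∑∏σ ∑∑∏σ≡2^m+2^m ⟩
      (+ 2) ^ m G + (+ 2) ^ m G                           ≡⟨ cong₂ _+_ (pos-^ 2 (m G)) (pos-^ 2 (m G)) ⟨
      + (2 ℕ.^ m G) + + (2 ℕ.^ m G)                       ≡⟨ ℤ.pos-+ (2 ℕ.^ m G) (2 ℕ.^ m G) ⟨
      + (2 ℕ.^ m G ℕ.+ 2 ℕ.^ m G)                         ∎)
      where open ≡-Reasoning

ν*3≡μ*2⇒2∣ν : ∀ {ν μ} → ν ℕ.* 3 ≡ μ ℕ.* 2 → 2 ∣ ν
ν*3≡μ*2⇒2∣ν {ν} {μ} 3ν≡2μ =
  ∣m+n∣m⇒∣n (subst (2 ∣_) (trans (sym 3ν≡2μ) (trans (ℕ.*-suc ν 2) (ℕ.+-comm ν (ν ℕ.* 2)))) (n∣m*n μ))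
            (n∣m*n ν)

N·2^ν≡2^μ+2^μ⇒N≡2^[ν/2+1] : ∀ N ν μ → ν ℕ.* 3 ≡ μ ℕ.* 2 → N ℕ.* 2 ℕ.^ ν ≡ 2 ℕ.^ μ ℕ.+ 2 ℕ.^ μ →
  N ≡ 2 ℕ.^ (ν ℕ./ 2 ℕ.+ 1)
N·2^ν≡2^μ+2^μ⇒N≡2^[ν/2+1] N ν μ 3ν≡2μ eq with divides r refl ← ν*3≡μ*2⇒2∣ν {ν} {μ} 3ν≡2μ
  with refl ← ℕ.*-cancelʳ-≡ μ (r ℕ.* 3) 2 (trans (sym 3ν≡2μ) (trans (ℕ.*-assoc r 2 3) (sym (ℕ.*-assoc r 3 2)))) =
  trans (ℕ.*-cancelʳ-≡ N (2 ℕ.^ (r ℕ.+ 1)) (2 ℕ.^ (r ℕ.* 2)) {{ℕ.m^n≢0 2 (r ℕ.* 2)}} (trans eq powers))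
        (cong (λ k → 2 ℕ.^ (k ℕ.+ 1)) (sym (m*n/n≡m r 2)))
  where
  exponents : ∀ r → 1 ℕ.+ r ℕ.* 3 ≡ (r ℕ.+ 1) ℕ.+ r ℕ.* 2
  exponents = solve-∀
  powers : 2 ℕ.^ (r ℕ.* 3) ℕ.+ 2 ℕ.^ (r ℕ.* 3) ≡ 2 ℕ.^ (r ℕ.+ 1) ℕ.* 2 ℕ.^ (r ℕ.* 2)
  powers = trans (cong (2 ℕ.^ (r ℕ.* 3) ℕ.+_) (sym (ℕ.+-identityʳ _)))
                 (trans (cong (2 ℕ.^_) (exponents r)) (ℕ.^-distribˡ-+-* 2 (r ℕ.+ 1) (r ℕ.* 2)))

open import Data.Nat using (_+_; _^_; _/_)

corollary2p5 : (G : Multigraph) → Loopless G → Cubic G → Connected G →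
    2 ∣ m G → M (LineGraph G) ≡ 2 ^ (n G / 2 + 1)
corollary2p5 G loopless cubic connected m-even = begin
  M (LineGraph G)                      ≡⟨ MatchingsAsOrientations.M≡countᵇ-isEvenᵇ G loopless cubic ⟩
  countᵇ isEvenᵇ (subsets (m G))       ≡⟨ N·2^ν≡2^μ+2^μ⇒N≡2^[ν/2+1] _ (n G) (m G) (handshake loopless cubic)
                                            (EvenOrientationCount.count·2^n≡2^m+2^m G connected m-even) ⟩
  2 ^ (n G / 2 + 1)                    ∎
  where
  open ≡-Reasoning
  open Incidence G using (handshake)
  open Orientations G using (isEvenᵇ)
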